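{- Let $p$ be a prime, $r\geq 0$, $A=\sum_{i=0}^{r}a_ip^i$, $B=\sum_{i=0}^{r}b_ip^i$ with $a_i,b_i\in\{0,\ldots,p-1\}$, and $AB=\sum_{i=0}^{2r+1}e_ip^i$ with $e_i\in\{0,\ldots,p-1\}$; set $a_i=b_i=0$ for $i>r$. Then $e_0\equiv a_0b_0\pmod p$ and for $1\leq t\leq 2r+1$, $$e_t\equiv\sum_{(\underline{l}_0,\ldots,\underline{l}_t)\in\mathbf{L}_p(t)}\ \prod_{k=0}^{t}\tau_{\underline{l}_k}(a_0,\ldots,a_k;b_0,\ldots,b_k)\pmod p.$$
   Context: Let $\mathbb{K}=\{\underline{k}=(k_1,\ldots,k_{p-1})\in\mathbb{Z}_{\geq0}^{p-1}:\sum_l k_l\leq p-1\}$ and $\underline 0=(0,\ldots,0)$. For $\underline k\neq\underline 0$ define the polynomial over $\mathbb{F}_p$ $$\pi_{\underline k}(x,y)=\frac{y(y-1)\cdots(y-\sum_{l=1}^{p-1}k_l+1)}{k_1!\cdots k_{p-1}!}\prod_{l=1}^{p-1}\left(\frac{x(x-1)\cdots(x-l+1)}{l!}\right)^{k_l},$$ and $\pi_{\underline 0}=1$. Let $K=|\mathbb{K}\setminus\{\underline0\}|$ and fix an enumeration $\underline k(1),\ldots,\underline k(K)$ of $\mathbb{K}\setminus\{\underline 0\}$. For $\underline k\in\mathbb K$ let $w(\underline k)=\sum_{j=1}^{p-1}jk_j$. For $\underline l=(l_1,\ldots,l_K)\in\mathbb{Z}_{\ge0}^K$ let $|\underline l|=\sum_j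 l_j$ and $\underline w\cdot\underline l=\sum_{j=1}^K w(\underline k(j))l_j$. Define $\mathbf{L}_p(t)$ as the set of tuples $(\underline l_0,\ldots,\underline l_t)$ with $\underline l_m\in\mathbb{Z}_{\ge0}^K$, $|\underline l_m|\leq 1+m$, and $\sum_{m=0}^t(\underline w\cdot\underline l_m)p^m=p^t$. For $0\le m$ and $\underline l\in\mathbb{Z}_{\ge0}^K$ with $|\underline l|\le 1+m$, let $\mathbf I(m,\underline l)$ be the set of tuples $(S_1,\ldots,S_K)$ of pairwise disjoint subsets of $\{0,1,\ldots,m\}$ with $|S_j|=l_j$, and define $$\tau_{\underline l}(x_0,\ldots,x_m;y_0,\ldots,y_m)=\sum_{(S_1,\ldots,S_K)\in\mathbf I(m,\underline l)}\prod_{j=1}^K\prod_{i\in S_j}\pi_{\underline k(j)}(x_i,y_{m-i}).$$ Integers are identified with their residues in $\mathbb F_p$ when evaluating these polynomials. -}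

module Defs where

open import Data.Bool using (Bool; true; false; _∧_; not; if_then_else_)
open import Data.Nat as ℕ using (ℕ; zero; suc; _∸_; _≡ᵇ_) renaming (_+_ to _+ℕ_; _*_ to _*ℕ_; _^_ to _^ℕ_)
open import Data.Nat using (_!)
open import Data.Integer using (ℤ; +_; _+_; _*_; _-_; _^_)
open import Data.Fin using (Fin; zero; suc; toℕ)
open import Data.Fin.Subset using (Subset; ∣_∣)
open import Data.Vec as Vec using (Vec; []; _∷_; lookup)
open import Data.List as List using (List; []; _∷_; [_]; map; concatMap; upTo; length; filterᵇ; filter)
open import Function using (_∘_)

ΣFin : (n : ℕ) → (Fin n → ℤ) → ℤ
ΣFin zero    f = + 0
ΣFin (suc n) f = f zero + ΣFin n (f ∘ suc)

ΠFin : (n : ℕ) → (Fin n → ℤ) → ℤ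
ΠFin zero    f = + 1
ΠFin (suc n) f = f zero * ΠFin n (f ∘ suc)

ΣFinℕ : (n : ℕ) → (Fin n → ℕ) → ℕ
ΣFinℕ zero    f = 0
ΣFinℕ (suc n) f = f zero +ℕ ΣFinℕ n (f ∘ suc)

Σ≤ : ℕ → (ℕ → ℕ) → ℕ
Σ≤ zero    f = f 0
Σ≤ (suc n) f = Σ≤ n f +ℕ f (suc n)

sumℤ : List ℤ → ℤ
sumℤ = List.foldr _+_ (+ 0)

-- Arithmetic of F_p, computed on integer representatives.
-- The inverse of an element d ≢ 0 (mod p) is d^(p-2) (Fermat); it is only
-- ever applied to factorials of numbers ≤ p-1, which are units mod p.

invₚ : ℕ → ℤ → ℤ
invₚ p d = d ^ (p ∸ 2)

fall : ℤ → ℕ → ℤ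
fall y s = ΠFin s (λ i → y - + toℕ i)

factℤ : ℕ → ℤ
factℤ n = + (n !)

-- π_k(x,y) for k = (k_1,…,k_{p-1}); index j : Fin (p-1) stands for l = j+1.
πₚ : (p : ℕ) → Vec ℕ (p ∸ 1) → ℤ → ℤ → ℤ
πₚ p k x y =
  fall y (Vec.sum k)
  * invₚ p (ΠFin (p ∸ 1) (λ j → factℤ (lookup k j)))
  * ΠFin (p ∸ 1) (λ j → (fall x (suc (toℕ j)) * invₚ p (factℤ (suc (toℕ j)))) ^ lookup k j)

wt : (p : ℕ) → Vec ℕ (p ∸ 1) → ℕ
wt p k = ΣFinℕ (p ∸ 1) (λ j → suc (toℕ j) *ℕ lookup k j)

-- Parameters: p and the fixed enumeration ks = (k(1),…,k(K)) of 𝕂 ∖ {0}.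

module _ (p : ℕ) (ks : List (Vec ℕ (p ∸ 1))) where

  K : ℕ
  K = length ks

  kk : Fin K → Vec ℕ (p ∸ 1)
  kk = List.lookup ks

  wdot : Vec ℕ K → ℕ
  wdot l = ΣFinℕ K (λ j → wt p (kk j) *ℕ lookup l j)

  boundedVecs : (n b : ℕ) → List (Vec ℕ n)
  boundedVecs zero    b = [ [] ]
  boundedVecs (suc n) b = concatMap (λ c → map (c ∷_) (boundedVecs n (b ∸ c))) (upTo (suc b))

  seqsFrom : (m c : ℕ) → List (List (Vec ℕ K))
  seqsFrom m zero    = [ [] ]
  seqsFrom m (suc c) = concatMap (λ l → map (l ∷_) (seqsFrom (suc m) c)) (boundedVecs K (suc m))

  weightSum : ℕ → List (Vec ℕ K) → ℕ
  weightSum m []       = 0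
  weightSum m (l ∷ ls) = wdot l *ℕ p ^ℕ m +ℕ weightSum (suc m) ls

  𝐋 : ℕ → List (List (Vec ℕ K))
  𝐋 t = filter (λ ls → weightSum 0 ls ℕ.≟ p ^ℕ t) (seqsFrom 0 (suc t))

  allSubsets : (n : ℕ) → List (Subset n)
  allSubsets zero    = [ [] ]
  allSubsets (suc n) = concatMap (λ s → (false ∷ s) ∷ (true ∷ s) ∷ []) (allSubsets n)

  allTuples : (j n : ℕ) → List (Vec (Subset n) j)
  allTuples zero    n = [ [] ]
  allTuples (suc j) n = concatMap (λ S → map (_∷ S) (allSubsets n)) (allTuples j n)

  disjointᵇ : ∀ {n} → Subset n → Subset n → Bool
  disjointᵇ []      []      = true
  disjointᵇ (a ∷ s) (b ∷ t) = not (a ∧ b) ∧ disjointᵇ s t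

  allᵇ : ∀ {A : Set} {n} → (A → Bool) → Vec A n → Bool
  allᵇ f []       = true
  allᵇ f (x ∷ xs) = f x ∧ allᵇ f xs

  pairwiseDisjointᵇ : ∀ {n j} → Vec (Subset n) j → Bool
  pairwiseDisjointᵇ []       = true
  pairwiseDisjointᵇ (s ∷ ss) = allᵇ (disjointᵇ s) ss ∧ pairwiseDisjointᵇ ss

  cardsᵇ : ∀ {n j} → Vec (Subset n) j → Vec ℕ j → Bool
  cardsᵇ []       []       = true
  cardsᵇ (s ∷ ss) (l ∷ ls) = (∣ s ∣ ≡ᵇ l) ∧ cardsᵇ ss ls

  𝐈 : (m : ℕ) → Vec ℕ K → List (Vec (Subset (suc m)) K)
  𝐈 m l = filterᵇ (λ S → pairwiseDisjointᵇ S ∧ cardsᵇ S l) (allTuples K (suc m))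

  τ : Vec ℕ K → (m : ℕ) → (ℕ → ℤ) → (ℕ → ℤ) → ℤ
  τ l m x y = sumℤ (map term (𝐈 m l))
    where
    term : Vec (Subset (suc m)) K → ℤ
    term S = ΠFin K (λ j → ΠFin (suc m) (λ i →
      if lookup (lookup S j) i
        then πₚ p (kk j) (x (toℕ i)) (y (m ∸ toℕ i))
        else + 1))

  τProd : ℕ → List (Vec ℕ K) → (ℕ → ℤ) → (ℕ → ℤ) → ℤ
  τProd m []       x y = + 1
  τProd m (l ∷ ls) x y = τ l m x y * τProd (suc m) ls x y

  rhs : ℕ → (ℕ → ℤ) → (ℕ → ℤ) → ℤ
  rhs t x y = sumℤ (map (λ ls → τProd 0 ls x y) (𝐋 t))

-- By Lucas's theorem e_t ≡ C(AB, p^t) (mod p): the digit e_t is the coefficient of z^(p^t) in (1+z)^(AB).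
-- Write AB = Σ_m c_m p^m with the carry-free convolution c_m = Σ_{i ≤ m} a_i b_(m-i); then
-- (1+z)^(AB) = Π_m (1+z)^(p^m c_m), where modulo p (1+z)^(p^m c_m) ≡ (1 + z^(p^m))^(c_m) and
-- (1+z)^(c_m) = Π_i (1+z)^(a_i b_(m-i)). For digits x, y < p the multinomial theorem applied to
-- ((1+z)^x)^y = (1 + Σ_{j<p} C(x,j) z^j)^y gives (1+z)^(xy) ≡ 1 + Σ_k π_k(x,y) z^(w(k)), because modulo p
-- the polynomial π_k(x,y) is the multinomial coefficient of y over k times Π_j C(x,j)^(k_j). Expanding the
-- product over i as a sum over tuples of disjoint index sets turns the m-th factor into Σ_l τ_l z^((w·l) p^m),
-- and the coefficient of z^(p^t) in the product of these factors over m ≤ t is the sum over 𝐋_p(t); the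
-- factors with m > t only affect the coefficients of z^N with N ≥ p^(t+1).

module Submission where

open import Algebra.Bundles using (CommutativeMonoid)
open import Data.Bool using (Bool; true; false; if_then_else_; _∧_; not)
import Data.Bool.Properties as Boolₚ
open import Data.Empty using (⊥-elim)
open import Data.Fin as Fin using (Fin; toℕ)
import Data.Fin.Properties as Finₚ
open import Data.Fin.Subset using (Subset; ∣_∣)
open import Data.Integer as ℤ using (ℤ; +_)
import Data.Integer.Properties as ℤₚ
import Data.Integer.Divisibility as ℤ∣
import Data.Integer.Divisibility.Signed as ℤ∣ₛ
open import Data.Integer.Tactic.RingSolver using (solve-∀)
open import Data.List as List using (List; []; _∷_; map; concatMap; filter; filterᵇ; upTo; applyUpTo; length)
open import Data.List.Membership.Propositional using (_∈_)
open import Data.List.Relation.Unary.Any using (here; there)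
import Data.List.Relation.Unary.All as All
open import Data.List.Relation.Unary.AllPairs using (_∷_)
open import Data.List.Relation.Unary.Unique.Propositional using (Unique)
open import Data.Nat as ℕ using (ℕ; zero; suc; _∸_; _≡ᵇ_; _≤_; _<_; z≤n; s≤s; _!; NonZero)
import Data.Nat.Properties as ℕₚ
import Data.Nat.Divisibility as ℕ∣
import Data.Nat.Tactic.RingSolver as ℕ-Solver
open import Data.Nat.Primality using (Prime; euclidsLemma)
open import Data.Product using (_×_; _,_; proj₁; proj₂; Σ)
open import Data.Sum using (inj₁; inj₂)
open import Data.Vec as Vec using (Vec; []; _∷_; lookup)
open import Function using (_∘_; id)
open import Function.Bundles using (_⇔_; Equivalence)
open import Relation.Binary.Bundles using (Setoid)
open import Relation.Binary.Definitions using (tri<; tri≈; tri>)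
open import Relation.Binary.PropositionalEquality
import Relation.Binary.Reasoning.Setoid as SetoidReasoning
open import Relation.Nullary using (¬_; Dec; yes; no; does)

open import Defs

open import Algebra.Properties.CommutativeSemigroup ℤₚ.+-commutativeSemigroup using ()
  renaming (interchange to +-interchange)
open import Algebra.Properties.CommutativeSemigroup ℤₚ.*-commutativeSemigroup using ()
  renaming (interchange to *-interchange; x∙yz≈y∙xz to *-left-comm)
open import Algebra.Properties.CommutativeSemigroup
    (CommutativeMonoid.commutativeSemigroup Boolₚ.∧-commutativeMonoid) using ()
  renaming (interchange to ∧-interchange)

-- Integer sequences are power series in z: conv is the Cauchy product, δ a is z^a and binom N is (1+z)^N.
module Series where
  open import Data.Integer using (_+_; _*_; _^_)

  ΣL : {A : Set} → List A → (A → ℤ) → ℤ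
  ΣL xs f = sumℤ (map f xs)

  ΣL-cong : {A : Set} (xs : List A) {f g : A → ℤ} → (∀ x → f x ≡ g x) → ΣL xs f ≡ ΣL xs g
  ΣL-cong []       e = refl
  ΣL-cong (x ∷ xs) e = cong₂ _+_ (e x) (ΣL-cong xs e)

  ΣL-cong∈ : {A : Set} (xs : List A) {f g : A → ℤ} → (∀ x → x ∈ xs → f x ≡ g x) → ΣL xs f ≡ ΣL xs g
  ΣL-cong∈ []       e = refl
  ΣL-cong∈ (x ∷ xs) e = cong₂ _+_ (e x (here refl)) (ΣL-cong∈ xs (λ y y∈ → e y (there y∈)))

  ΣL-zero : {A : Set} (xs : List A) → ΣL xs (λ _ → + 0) ≡ + 0
  ΣL-zero []       = refl
  ΣL-zero (x ∷ xs) = trans (ℤₚ.+-identityˡ _) (ΣL-zero xs)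

  ΣL-++ : {A : Set} (xs ys : List A) (f : A → ℤ) → ΣL (xs List.++ ys) f ≡ ΣL xs f + ΣL ys f
  ΣL-++ []       ys f = sym (ℤₚ.+-identityˡ _)
  ΣL-++ (x ∷ xs) ys f = trans (cong (_+_ (f x)) (ΣL-++ xs ys f)) (sym (ℤₚ.+-assoc (f x) _ _))

  ΣL-concatMap : {A B : Set} (g : A → List B) (xs : List A) (f : B → ℤ) →
    ΣL (concatMap g xs) f ≡ ΣL xs (λ x → ΣL (g x) f)
  ΣL-concatMap g []       f = refl
  ΣL-concatMap g (x ∷ xs) f =
    trans (ΣL-++ (g x) (concatMap g xs) f) (cong (_+_ (ΣL (g x) f)) (ΣL-concatMap g xs f))

  ΣL-map : {A B : Set} (g : A → B) (xs : List A) (f : B → ℤ) → ΣL (map g xs) f ≡ ΣL xs (f ∘ g)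
  ΣL-map g []       f = refl
  ΣL-map g (x ∷ xs) f = cong (_+_ (f (g x))) (ΣL-map g xs f)

  ΣL-+ : {A : Set} (xs : List A) (f g : A → ℤ) → ΣL xs (λ x → f x + g x) ≡ ΣL xs f + ΣL xs g
  ΣL-+ []       f g = refl
  ΣL-+ (x ∷ xs) f g =
    trans (cong (_+_ (f x + g x)) (ΣL-+ xs f g)) (+-interchange (f x) (g x) (ΣL xs f) (ΣL xs g))

  ΣL-*ˡ : {A : Set} (xs : List A) (c : ℤ) (f : A → ℤ) → ΣL xs (λ x → c * f x) ≡ c * ΣL xs f
  ΣL-*ˡ []       c f = sym (ℤₚ.*-zeroʳ c)
  ΣL-*ˡ (x ∷ xs) c f = trans (cong (_+_ (c * f x)) (ΣL-*ˡ xs c f)) (sym (ℤₚ.*-distribˡ-+ c (f x) _))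

  ΣL-*ʳ : {A : Set} (xs : List A) (f : A → ℤ) (c : ℤ) → ΣL xs f * c ≡ ΣL xs (λ x → f x * c)
  ΣL-*ʳ xs f c = trans (ℤₚ.*-comm (ΣL xs f) c)
    (trans (sym (ΣL-*ˡ xs c f)) (ΣL-cong xs (λ x → ℤₚ.*-comm c (f x))))

  ΣL-comm : {A B : Set} (xs : List A) (ys : List B) (f : A → B → ℤ) →
    ΣL xs (λ x → ΣL ys (f x)) ≡ ΣL ys (λ y → ΣL xs (λ x → f x y))
  ΣL-comm []       ys f = sym (ΣL-zero ys)
  ΣL-comm (x ∷ xs) ys f = trans (cong (_+_ (ΣL ys (f x))) (ΣL-comm xs ys f))
    (sym (ΣL-+ ys (f x) (λ y → ΣL xs (λ x' → f x' y))))

  ΣL-filterᵇ : {A : Set} (P : A → Bool) (xs : List A) (f : A → ℤ) →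
    ΣL (filterᵇ P xs) f ≡ ΣL xs (λ x → if P x then f x else + 0)
  ΣL-filterᵇ P []       f = refl
  ΣL-filterᵇ P (x ∷ xs) f with P x
  ... | true  = cong (_+_ (f x)) (ΣL-filterᵇ P xs f)
  ... | false = trans (ΣL-filterᵇ P xs f) (sym (ℤₚ.+-identityˡ _))

  ΣL-filter : {A : Set} {P : A → Set} (P? : (x : A) → Dec (P x)) (xs : List A) (f : A → ℤ) →
    ΣL (filter P? xs) f ≡ ΣL xs (λ x → if does (P? x) then f x else + 0)
  ΣL-filter P? []       f = refl
  ΣL-filter P? (x ∷ xs) f with does (P? x)
  ... | true  = cong (_+_ (f x)) (ΣL-filter P? xs f)
  ... | false = trans (ΣL-filter P? xs f) (sym (ℤₚ.+-identityˡ _))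

  Σ< : ℕ → (ℕ → ℤ) → ℤ
  Σ< zero    f = + 0
  Σ< (suc n) f = f 0 + Σ< n (f ∘ suc)

  Σ<-cong : ∀ n {f g : ℕ → ℤ} → (∀ i → i < n → f i ≡ g i) → Σ< n f ≡ Σ< n g
  Σ<-cong zero    e = refl
  Σ<-cong (suc n) e = cong₂ _+_ (e 0 (s≤s z≤n)) (Σ<-cong n (λ i i<n → e (suc i) (s≤s i<n)))

  Σ<-zero : ∀ n {f : ℕ → ℤ} → (∀ i → f i ≡ + 0) → Σ< n f ≡ + 0
  Σ<-zero zero    e = refl
  Σ<-zero (suc n) e = cong₂ _+_ (e 0) (Σ<-zero n (e ∘ suc))

  Σ<-truncate : ∀ A d {h : ℕ → ℤ} → (∀ j → A ≤ j → h j ≡ + 0) → Σ< (A ℕ.+ d) h ≡ Σ< A h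
  Σ<-truncate zero    d     e = Σ<-zero d (λ j → e j z≤n)
  Σ<-truncate (suc A) d {h} e = cong (_+_ (h 0)) (Σ<-truncate A d (λ j A≤j → e (suc j) (s≤s A≤j)))

  Σ<-+ : ∀ n (f g : ℕ → ℤ) → Σ< n (λ i → f i + g i) ≡ Σ< n f + Σ< n g
  Σ<-+ zero    f g = refl
  Σ<-+ (suc n) f g =
    trans (cong (_+_ (f 0 + g 0)) (Σ<-+ n (f ∘ suc) (g ∘ suc))) (+-interchange (f 0) (g 0) _ _)

  Σ<-*ˡ : ∀ n c (f : ℕ → ℤ) → Σ< n (λ i → c * f i) ≡ c * Σ< n f
  Σ<-*ˡ zero    c f = sym (ℤₚ.*-zeroʳ c)
  Σ<-*ˡ (suc n) c f = trans (cong (_+_ (c * f 0)) (Σ<-*ˡ n c (f ∘ suc))) (sym (ℤₚ.*-distribˡ-+ c (f 0) _))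

  ΣL-applyUpTo : ∀ n (h : ℕ → ℕ) (f : ℕ → ℤ) → ΣL (applyUpTo h n) f ≡ Σ< n (f ∘ h)
  ΣL-applyUpTo zero    h f = refl
  ΣL-applyUpTo (suc n) h f = cong (_+_ (f (h 0))) (ΣL-applyUpTo n (h ∘ suc) f)

  ΣL-upTo : ∀ n (f : ℕ → ℤ) → ΣL (upTo n) f ≡ Σ< n f
  ΣL-upTo n f = ΣL-applyUpTo n id f

  ΣFin≡Σ< : ∀ n (F : ℕ → ℤ) → ΣFin n (λ i → F (toℕ i)) ≡ Σ< n F
  ΣFin≡Σ< zero    F = refl
  ΣFin≡Σ< (suc n) F = cong (_+_ (F 0)) (ΣFin≡Σ< n (F ∘ suc))

  ΣFin-cong : ∀ n {f g : Fin n → ℤ} → (∀ l → f l ≡ g l) → ΣFin n f ≡ ΣFin n g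
  ΣFin-cong zero    e = refl
  ΣFin-cong (suc n) e = cong₂ _+_ (e Fin.zero) (ΣFin-cong n (e ∘ Fin.suc))

  ΣFin-zero : ∀ n {f : Fin n → ℤ} → (∀ l → f l ≡ + 0) → ΣFin n f ≡ + 0
  ΣFin-zero zero    e = refl
  ΣFin-zero (suc n) e = cong₂ _+_ (e Fin.zero) (ΣFin-zero n (e ∘ Fin.suc))

  ΣFin-*ˡ : ∀ n c (f : Fin n → ℤ) → ΣFin n (λ l → c * f l) ≡ c * ΣFin n f
  ΣFin-*ˡ zero    c f = sym (ℤₚ.*-zeroʳ c)
  ΣFin-*ˡ (suc n) c f =
    trans (cong (_+_ (c * f Fin.zero)) (ΣFin-*ˡ n c (f ∘ Fin.suc))) (sym (ℤₚ.*-distribˡ-+ c _ _))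

  ΣFin-lookup : {A : Set} (xs : List A) (f : A → ℤ) → ΣFin (length xs) (f ∘ List.lookup xs) ≡ ΣL xs f
  ΣFin-lookup []       f = refl
  ΣFin-lookup (x ∷ xs) f = cong (_+_ (f x)) (ΣFin-lookup xs f)

  ΣL-ΣFin : {A : Set} (xs : List A) (n : ℕ) (f : A → Fin n → ℤ) →
    ΣL xs (λ v → ΣFin n (f v)) ≡ ΣFin n (λ l → ΣL xs (λ v → f v l))
  ΣL-ΣFin xs zero    f = ΣL-zero xs
  ΣL-ΣFin xs (suc n) f = trans (ΣL-+ xs (λ v → f v Fin.zero) (λ v → ΣFin n (f v ∘ Fin.suc)))
    (cong (_+_ (ΣL xs (λ v → f v Fin.zero))) (ΣL-ΣFin xs n (λ v → f v ∘ Fin.suc)))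

  ΠFin-cong : ∀ n {f g : Fin n → ℤ} → (∀ l → f l ≡ g l) → ΠFin n f ≡ ΠFin n g
  ΠFin-cong zero    e = refl
  ΠFin-cong (suc n) e = cong₂ _*_ (e Fin.zero) (ΠFin-cong n (e ∘ Fin.suc))

  ΠFin-one : ∀ n {f : Fin n → ℤ} → (∀ j → f j ≡ + 1) → ΠFin n f ≡ + 1
  ΠFin-one zero    e = refl
  ΠFin-one (suc n) e = cong₂ _*_ (e Fin.zero) (ΠFin-one n (e ∘ Fin.suc))

  ΠFin-* : ∀ n (f g : Fin n → ℤ) → ΠFin n (λ j → f j * g j) ≡ ΠFin n f * ΠFin n g
  ΠFin-* zero    f g = refl
  ΠFin-* (suc n) f g = trans (cong (_*_ (f Fin.zero * g Fin.zero)) (ΠFin-* n (f ∘ Fin.suc) (g ∘ Fin.suc)))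
    (*-interchange (f Fin.zero) (g Fin.zero) _ _)

  conv : (ℕ → ℤ) → (ℕ → ℤ) → ℕ → ℤ
  conv f g zero    = f 0 * g 0
  conv f g (suc n) = f 0 * g (suc n) + conv (f ∘ suc) g n

  conv≡Σ< : ∀ f g n → conv f g n ≡ Σ< (suc n) (λ i → f i * g (n ∸ i))
  conv≡Σ< f g zero    = sym (ℤₚ.+-identityʳ _)
  conv≡Σ< f g (suc n) = cong (_+_ (f 0 * g (suc n))) (conv≡Σ< (f ∘ suc) g n)

  conv-cong : ∀ n {f f′ g g′ : ℕ → ℤ} → (∀ i → i ≤ n → f i ≡ f′ i) → (∀ i → i ≤ n → g i ≡ g′ i) →
    conv f g n ≡ conv f′ g′ n
  conv-cong zero    ef eg = cong₂ _*_ (ef 0 z≤n) (eg 0 z≤n)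
  conv-cong (suc n) ef eg = cong₂ _+_ (cong₂ _*_ (ef 0 z≤n) (eg (suc n) ℕₚ.≤-refl))
    (conv-cong n (λ i i≤n → ef (suc i) (s≤s i≤n)) (λ i i≤n → eg i (ℕₚ.m≤n⇒m≤1+n i≤n)))

  conv-+ˡ : ∀ f f′ g n → conv (λ i → f i + f′ i) g n ≡ conv f g n + conv f′ g n
  conv-+ˡ f f′ g zero    = ℤₚ.*-distribʳ-+ (g 0) (f 0) (f′ 0)
  conv-+ˡ f f′ g (suc n) =
    trans (cong₂ _+_ (ℤₚ.*-distribʳ-+ (g (suc n)) (f 0) (f′ 0)) (conv-+ˡ (f ∘ suc) (f′ ∘ suc) g n))
      (+-interchange (f 0 * g (suc n)) (f′ 0 * g (suc n)) _ _)

  conv-+ʳ : ∀ f g g′ n → conv f (λ i → g i + g′ i) n ≡ conv f g n + conv f g′ n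
  conv-+ʳ f g g′ zero    = ℤₚ.*-distribˡ-+ (f 0) (g 0) (g′ 0)
  conv-+ʳ f g g′ (suc n) =
    trans (cong₂ _+_ (ℤₚ.*-distribˡ-+ (f 0) (g (suc n)) (g′ (suc n))) (conv-+ʳ (f ∘ suc) g g′ n))
      (+-interchange (f 0 * g (suc n)) (f 0 * g′ (suc n)) _ _)

  conv-*ˡ : ∀ c f g n → conv (λ i → c * f i) g n ≡ c * conv f g n
  conv-*ˡ c f g zero    = ℤₚ.*-assoc c (f 0) (g 0)
  conv-*ˡ c f g (suc n) = trans (cong₂ _+_ (ℤₚ.*-assoc c (f 0) (g (suc n))) (conv-*ˡ c (f ∘ suc) g n))
    (sym (ℤₚ.*-distribˡ-+ c _ _))

  conv-*ʳ : ∀ c f g n → conv f (λ i → c * g i) n ≡ c * conv f g n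
  conv-*ʳ c f g zero    = *-left-comm (f 0) c (g 0)
  conv-*ʳ c f g (suc n) = trans (cong₂ _+_ (*-left-comm (f 0) c (g (suc n))) (conv-*ʳ c (f ∘ suc) g n))
    (sym (ℤₚ.*-distribˡ-+ c _ _))

  conv-zeroˡ : ∀ g n → conv (λ _ → + 0) g n ≡ + 0
  conv-zeroˡ g zero    = refl
  conv-zeroˡ g (suc n) = trans (ℤₚ.+-identityˡ _) (conv-zeroˡ g n)

  conv-zeroʳ : ∀ f n → conv f (λ _ → + 0) n ≡ + 0
  conv-zeroʳ f zero    = ℤₚ.*-zeroʳ (f 0)
  conv-zeroʳ f (suc n) = cong₂ _+_ (ℤₚ.*-zeroʳ (f 0)) (conv-zeroʳ (f ∘ suc) n)

  conv-ΣLˡ : {A : Set} (xs : List A) (F : A → ℕ → ℤ) (g : ℕ → ℤ) (n : ℕ) →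
    conv (λ i → ΣL xs (λ x → F x i)) g n ≡ ΣL xs (λ x → conv (F x) g n)
  conv-ΣLˡ []       F g n = conv-zeroˡ g n
  conv-ΣLˡ (x ∷ xs) F g n = trans (conv-+ˡ (F x) (λ i → ΣL xs (λ x′ → F x′ i)) g n)
    (cong (_+_ (conv (F x) g n)) (conv-ΣLˡ xs F g n))

  conv-ΣLʳ : {A : Set} (xs : List A) (f : ℕ → ℤ) (F : A → ℕ → ℤ) (n : ℕ) →
    conv f (λ i → ΣL xs (λ x → F x i)) n ≡ ΣL xs (λ x → conv f (F x) n)
  conv-ΣLʳ []       f F n = conv-zeroʳ f n
  conv-ΣLʳ (x ∷ xs) f F n = trans (conv-+ʳ f (F x) (λ i → ΣL xs (λ x′ → F x′ i)) n)
    (cong (_+_ (conv f (F x) n)) (conv-ΣLʳ xs f F n))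

  conv-ΣFinˡ : ∀ n (F : Fin n → ℕ → ℤ) (g : ℕ → ℤ) (m : ℕ) →
    conv (λ i → ΣFin n (λ l → F l i)) g m ≡ ΣFin n (λ l → conv (F l) g m)
  conv-ΣFinˡ zero    F g m = conv-zeroˡ g m
  conv-ΣFinˡ (suc n) F g m = trans (conv-+ˡ (F Fin.zero) (λ i → ΣFin n (λ l → F (Fin.suc l) i)) g m)
    (cong (_+_ (conv (F Fin.zero) g m)) (conv-ΣFinˡ n (F ∘ Fin.suc) g m))

  δ : ℕ → ℕ → ℤ
  δ a n = if a ≡ᵇ n then + 1 else + 0

  δ-refl : ∀ a → δ a a ≡ + 1
  δ-refl zero    = refl
  δ-refl (suc a) = δ-refl a

  δ-≢ : ∀ a n → a ≢ n → δ a n ≡ + 0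
  δ-≢ zero    zero    a≢n = ⊥-elim (a≢n refl)
  δ-≢ zero    (suc n) a≢n = refl
  δ-≢ (suc a) zero    a≢n = refl
  δ-≢ (suc a) (suc n) a≢n = δ-≢ a n (a≢n ∘ cong suc)

  ≡ᵇ-sym : ∀ a b → (a ≡ᵇ b) ≡ (b ≡ᵇ a)
  ≡ᵇ-sym zero    zero    = refl
  ≡ᵇ-sym zero    (suc b) = refl
  ≡ᵇ-sym (suc a) zero    = refl
  ≡ᵇ-sym (suc a) (suc b) = ≡ᵇ-sym a b

  δ-sym : ∀ a b → δ a b ≡ δ b a
  δ-sym a b = cong (λ β → if β then + 1 else + 0) (≡ᵇ-sym a b)

  δ-cong⇔ : ∀ {a b c d} → (a ≡ b → c ≡ d) → (c ≡ d → a ≡ b) → δ a b ≡ δ c d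
  δ-cong⇔ {a} {b} {c} {d} f g with a ℕₚ.≟ b
  ... | yes refl = trans (δ-refl a) (sym (trans (cong (δ c) (sym (f refl))) (δ-refl c)))
  ... | no a≢b   = trans (δ-≢ a b a≢b) (sym (δ-≢ c d (a≢b ∘ g)))

  Σ<-δ : ∀ n a (f : ℕ → ℤ) → a < n → Σ< n (λ i → δ a i * f i) ≡ f a
  Σ<-δ (suc n) zero    f _         =
    trans (cong₂ _+_ (ℤₚ.*-identityˡ (f 0)) (Σ<-zero n (λ i → refl))) (ℤₚ.+-identityʳ (f 0))
  Σ<-δ (suc n) (suc a) f (s≤s a<n) = trans (ℤₚ.+-identityˡ _) (Σ<-δ n a (f ∘ suc) a<n)

  conv-δ : ∀ a g n → a ≤ n → conv (δ a) g n ≡ g (n ∸ a)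
  conv-δ zero    g zero    _         = ℤₚ.*-identityˡ (g 0)
  conv-δ zero    g (suc n) _         =
    trans (cong₂ _+_ (ℤₚ.*-identityˡ (g (suc n))) (conv-zeroˡ g n)) (ℤₚ.+-identityʳ _)
  conv-δ (suc a) g (suc n) (s≤s a≤n) = trans (ℤₚ.+-identityˡ _) (conv-δ a g n a≤n)

  conv-δ-< : ∀ a g n → n < a → conv (δ a) g n ≡ + 0
  conv-δ-< (suc a) g zero    _         = refl
  conv-δ-< (suc a) g (suc n) (s≤s n<a) = trans (ℤₚ.+-identityˡ _) (conv-δ-< a g n n<a)

  conv-δ-δ : ∀ a b n → conv (δ a) (δ b) n ≡ δ (a ℕ.+ b) n
  conv-δ-δ a b n with a ℕₚ.≤? n
  ... | yes a≤n = trans (conv-δ a (δ b) n a≤n)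
    (δ-cong⇔ (λ e → trans (cong (a ℕ.+_) e) (ℕₚ.m+[n∸m]≡n a≤n)) (λ e → trans (sym (ℕₚ.m+n∸m≡n a b)) (cong (_∸ a) e)))
  ... | no a≰n  = trans (conv-δ-< a (δ b) n (ℕₚ.≰⇒> a≰n))
    (sym (δ-≢ (a ℕ.+ b) n (λ e → a≰n (subst (a ≤_) e (ℕₚ.m≤m+n a b)))))

  conv-δ-δ*ʳ : ∀ a b d n → conv (δ a) (λ i → δ b i * d) n ≡ δ (a ℕ.+ b) n * d
  conv-δ-δ*ʳ a b d n = begin
      conv (δ a) (λ i → δ b i * d) n
    ≡⟨ conv-cong n (λ _ _ → refl) (λ i _ → ℤₚ.*-comm (δ b i) d) ⟩
      conv (δ a) (λ i → d * δ b i) n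
    ≡⟨ conv-*ʳ d (δ a) (δ b) n ⟩
      d * conv (δ a) (δ b) n
    ≡⟨ cong (d *_) (conv-δ-δ a b n) ⟩
      d * δ (a ℕ.+ b) n
    ≡⟨ ℤₚ.*-comm d _ ⟩
      δ (a ℕ.+ b) n * d
    ∎
    where open ≡-Reasoning

  choose : ℕ → ℕ → ℕ
  choose _       zero    = 1
  choose zero    (suc k) = 0
  choose (suc n) (suc k) = choose n k ℕ.+ choose n (suc k)

  binom : ℕ → ℕ → ℤ
  binom n k = + choose n k

  n<k⇒choose≡0 : ∀ n k → n < k → choose n k ≡ 0
  n<k⇒choose≡0 zero    (suc k) _         = refl
  n<k⇒choose≡0 (suc n) (suc k) (s≤s n<k) =
    cong₂ ℕ._+_ (n<k⇒choose≡0 n k n<k) (n<k⇒choose≡0 n (suc k) (ℕₚ.m<n⇒m<1+n n<k))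

  choose-n-1 : ∀ n → choose n 1 ≡ n
  choose-n-1 zero    = refl
  choose-n-1 (suc n) = cong suc (choose-n-1 n)

  choose-n-n : ∀ n → choose n n ≡ 1
  choose-n-n zero    = refl
  choose-n-n (suc n) = cong₂ ℕ._+_ (choose-n-n n) (n<k⇒choose≡0 n (suc n) ℕₚ.≤-refl)

  binom-0 : ∀ n → binom 0 n ≡ δ 0 n
  binom-0 zero    = refl
  binom-0 (suc n) = refl

  conv-binom-suc : ∀ a g n → conv (binom (suc a)) g (suc n) ≡ conv (binom a) g (suc n) + conv (binom a) g n
  conv-binom-suc a g n = begin
      + 1 * g (suc n) + conv (binom (suc a) ∘ suc) g n
    ≡⟨ cong (_+_ (+ 1 * g (suc n)))
         (trans (conv-cong n (λ i _ → ℤₚ.pos-+ (choose a i) (choose a (suc i))) (λ _ _ → refl))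
          (conv-+ˡ (binom a) (binom a ∘ suc) g n)) ⟩
      + 1 * g (suc n) + (conv (binom a) g n + conv (binom a ∘ suc) g n)
    ≡⟨ rearrange (+ 1 * g (suc n)) (conv (binom a) g n) (conv (binom a ∘ suc) g n) ⟩
      (+ 1 * g (suc n) + conv (binom a ∘ suc) g n) + conv (binom a) g n
    ∎
    where
    open ≡-Reasoning
    rearrange : ∀ x y z → x + (y + z) ≡ (x + z) + y
    rearrange = solve-∀

  vandermonde : ∀ a b n → binom (a ℕ.+ b) n ≡ conv (binom a) (binom b) n
  vandermonde zero    b n       = sym
      (trans (conv-cong n (λ i _ → binom-0 i) (λ _ _ → refl)) (conv-δ 0 (binom b) n z≤n))
  vandermonde (suc a) b zero    = refl
  vandermonde (suc a) b (suc n) = begin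
      + (choose (a ℕ.+ b) n ℕ.+ choose (a ℕ.+ b) (suc n))
    ≡⟨ ℤₚ.pos-+ (choose (a ℕ.+ b) n) _ ⟩
      binom (a ℕ.+ b) n + binom (a ℕ.+ b) (suc n)
    ≡⟨ cong₂ _+_ (vandermonde a b n) (vandermonde a b (suc n)) ⟩
      conv (binom a) (binom b) n + conv (binom a) (binom b) (suc n)
    ≡⟨ ℤₚ.+-comm (conv (binom a) (binom b) n) _ ⟩
      conv (binom a) (binom b) (suc n) + conv (binom a) (binom b) n
    ≡⟨ conv-binom-suc a (binom b) n ⟨
      conv (binom (suc a)) (binom b) (suc n)
    ∎
    where open ≡-Reasoning

  choose-absorb : ∀ n k → suc k ℕ.* choose (suc n) (suc k) ≡ suc n ℕ.* choose n k
  choose-absorb zero    zero    = refl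
  choose-absorb zero    (suc k) = ℕₚ.*-zeroʳ (suc (suc k))
  choose-absorb (suc n) zero    =
    trans (ℕₚ.*-identityˡ _) (trans (choose-n-1 (suc (suc n))) (sym (ℕₚ.*-identityʳ _)))
  choose-absorb (suc n) (suc k) = begin
      suc (suc k) ℕ.* (choose (suc n) (suc k) ℕ.+ choose (suc n) (suc (suc k)))
    ≡⟨ ℕₚ.*-distribˡ-+ (suc (suc k)) (choose (suc n) (suc k)) _ ⟩
      suc (suc k) ℕ.* choose (suc n) (suc k) ℕ.+ suc (suc k) ℕ.* choose (suc n) (suc (suc k))
    ≡⟨ cong₂ ℕ._+_ (cong (choose (suc n) (suc k) ℕ.+_) (choose-absorb n k)) (choose-absorb n (suc k)) ⟩
      choose (suc n) (suc k) ℕ.+ suc n ℕ.* choose n k ℕ.+ suc n ℕ.* choose n (suc k)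
    ≡⟨ rearrange (choose n k) (choose n (suc k)) n ⟩
      suc (suc n) ℕ.* (choose n k ℕ.+ choose n (suc k))
    ∎
    where
    open ≡-Reasoning
    rearrange : ∀ a b n → a ℕ.+ b ℕ.+ suc n ℕ.* a ℕ.+ suc n ℕ.* b ≡ suc (suc n) ℕ.* (a ℕ.+ b)
    rearrange = ℕ-Solver.solve-∀

  binomial-theorem : ∀ (x : ℤ) n → (x + + 1) ^ n ≡ Σ< (suc n) (λ i → binom n i * x ^ i)
  binomial-theorem x zero    = refl
  binomial-theorem x (suc n) = begin
      (x + + 1) * (x + + 1) ^ n
    ≡⟨ cong ((x + + 1) *_) (binomial-theorem x n) ⟩
      (x + + 1) * (+ 1 * + 1 + Σ< n shifted)
    ≡⟨ expand x (Σ< n shifted) ⟩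
      + 1 * + 1 + (x * Σ< (suc n) term + Σ< n shifted)
    ≡⟨ cong (λ s → + 1 * + 1 + (s + Σ< n shifted)) (Σ<-*ˡ (suc n) x term) ⟨
      + 1 * + 1 + (Σ< (suc n) (λ i → x * term i) + Σ< n shifted)
    ≡⟨ cong (λ s → + 1 * + 1 + (Σ< (suc n) (λ i → x * term i) + s)) shifted-extend ⟩
      + 1 * + 1 + (Σ< (suc n) (λ i → x * term i) + Σ< (suc n) shifted)
    ≡⟨ cong (_+_ (+ 1 * + 1)) (Σ<-+ (suc n) (λ i → x * term i) shifted) ⟨
      + 1 * + 1 + Σ< (suc n) (λ i → x * term i + shifted i)
    ≡⟨ cong (_+_ (+ 1 * + 1)) (Σ<-cong (suc n) (λ i _ → pascal i)) ⟩
      + 1 * + 1 + Σ< (suc n) (λ i → binom (suc n) (suc i) * x ^ suc i)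
    ∎
    where
    open ≡-Reasoning
    term shifted : ℕ → ℤ
    term i    = binom n i * x ^ i
    shifted i = binom n (suc i) * x ^ suc i
    expand : ∀ x t → (x + + 1) * (+ 1 * + 1 + t) ≡ + 1 * + 1 + (x * (+ 1 * + 1 + t) + t)
    expand = solve-∀
    shifted-extend : Σ< n shifted ≡ Σ< (suc n) shifted
    shifted-extend = trans (sym (Σ<-truncate n 1
        (λ j n≤j → cong (_* x ^ suc j) (cong +_ (n<k⇒choose≡0 n (suc j) (s≤s n≤j))))))
      (cong (λ m → Σ< m shifted) (ℕₚ.+-comm n 1))
    distrib : ∀ x a y b → x * (a * y) + b * (x * y) ≡ (a + b) * (x * y)
    distrib = solve-∀
    pascal : ∀ i → x * term i + shifted i ≡ binom (suc n) (suc i) * x ^ suc i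
    pascal i = trans (distrib x (binom n i) (x ^ i) (binom n (suc i)))
      (cong (_* (x * x ^ i)) (sym (ℤₚ.pos-+ (choose n i) (choose n (suc i)))))

module Congruence (p : ℕ) (p-prime : Prime p) where
  open import Data.Integer using (_+_; _*_; _-_; -_; _^_)
  open import Data.Nat.Primality using (prime⇒nonTrivial; prime⇒nonZero)
  open Series

  instance
    p-nonZero : NonZero p
    p-nonZero = prime⇒nonZero p-prime

  1<p : 1 < p
  1<p = ℕ.nonTrivial⇒n>1 p {{prime⇒nonTrivial p-prime}}

  0<p : 0 < p
  0<p = ℕₚ.<-trans (s≤s z≤n) 1<p

  suc[p∸1]≡p : suc (p ∸ 1) ≡ p
  suc[p∸1]≡p = ℕₚ.m+[n∸m]≡n {1} {p} (ℕₚ.<⇒≤ 1<p)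

  infix 4 _≈_
  record _≈_ (x y : ℤ) : Set where
    constructor mk≈
    field p∣x-y : (+ p) ℤ∣ₛ.∣ (x - y)

  ≡⇒≈ : ∀ {x y} → x ≡ y → x ≈ y
  ≡⇒≈ {x} refl = mk≈ (ℤ∣ₛ.divides (+ 0) (ℤₚ.+-inverseʳ x))

  ≈-refl : ∀ {x} → x ≈ x
  ≈-refl = ≡⇒≈ refl

  ≈-sym : ∀ {x y} → x ≈ y → y ≈ x
  ≈-sym {x} {y} (mk≈ d) = mk≈ (subst ((+ p) ℤ∣ₛ.∣_) (negate x y) (ℤ∣ₛ.∣m⇒∣-m d))
    where
    negate : ∀ x y → - (x - y) ≡ y - x
    negate = solve-∀

  ≈-trans : ∀ {x y z} → x ≈ y → y ≈ z → x ≈ z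
  ≈-trans {x} {y} {z} (mk≈ d) (mk≈ e) = mk≈ (subst ((+ p) ℤ∣ₛ.∣_) (telescope x y z) (ℤ∣ₛ.∣m∣n⇒∣m+n d e))
    where
    telescope : ∀ x y z → (x - y) + (y - z) ≡ x - z
    telescope = solve-∀

  ≈-setoid : Setoid _ _
  ≈-setoid = record
    { Carrier       = ℤ
    ; _≈_           = _≈_
    ; isEquivalence = record { refl = ≈-refl ; sym = ≈-sym ; trans = ≈-trans }
    }

  module ≈-Reasoning = SetoidReasoning ≈-setoid

  ≈-+ : ∀ {a b c d} → a ≈ b → c ≈ d → a + c ≈ b + d
  ≈-+ {a} {b} {c} {d} (mk≈ u) (mk≈ v) = mk≈ (subst ((+ p) ℤ∣ₛ.∣_) (regroup a b c d) (ℤ∣ₛ.∣m∣n⇒∣m+n u v))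
    where
    regroup : ∀ a b c d → (a - b) + (c - d) ≡ (a + c) - (b + d)
    regroup = solve-∀

  ≈-* : ∀ {a b c d} → a ≈ b → c ≈ d → a * c ≈ b * d
  ≈-* {a} {b} {c} {d} (mk≈ u) (mk≈ v) =
    mk≈ (subst ((+ p) ℤ∣ₛ.∣_) (regroup a b c d) (ℤ∣ₛ.∣m∣n⇒∣m+n (ℤ∣ₛ.∣m⇒∣m*n c u) (ℤ∣ₛ.∣n⇒∣m*n b v)))
    where
    regroup : ∀ a b c d → (a - b) * c + b * (c - d) ≡ a * c - b * d
    regroup = solve-∀

  ≈-^ : ∀ {a b} n → a ≈ b → a ^ n ≈ b ^ n
  ≈-^ zero    e = ≈-refl
  ≈-^ (suc n) e = ≈-* e (≈-^ n e)

  p∣n⇒n≈0 : ∀ {n} → p ℕ∣.∣ n → + n ≈ + 0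
  p∣n⇒n≈0 {n} d = mk≈ (subst ((+ p) ℤ∣ₛ.∣_) (sym (ℤₚ.+-identityʳ (+ n))) (ℤ∣ₛ.∣ᵤ⇒∣ d))

  ≈⇒∣ : ∀ {x y} → x ≈ y → (+ p) ℤ∣.∣ (x - y)
  ≈⇒∣ (mk≈ d) = ℤ∣ₛ.∣⇒∣ᵤ d

  Σ<-≈ : ∀ n {f g : ℕ → ℤ} → (∀ i → i < n → f i ≈ g i) → Σ< n f ≈ Σ< n g
  Σ<-≈ zero    e = ≈-refl
  Σ<-≈ (suc n) e = ≈-+ (e 0 (s≤s z≤n)) (Σ<-≈ n (λ i i<n → e (suc i) (s≤s i<n)))

  ΠFin-≈ : ∀ n {f g : Fin n → ℤ} → (∀ i → f i ≈ g i) → ΠFin n f ≈ ΠFin n g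
  ΠFin-≈ zero    e = ≈-refl
  ΠFin-≈ (suc n) e = ≈-* (e Fin.zero) (ΠFin-≈ n (e ∘ Fin.suc))

  conv-≈ : ∀ n {f f′ g g′ : ℕ → ℤ} → (∀ i → i ≤ n → f i ≈ f′ i) → (∀ i → i ≤ n → g i ≈ g′ i) →
    conv f g n ≈ conv f′ g′ n
  conv-≈ zero    ef eg = ≈-* (ef 0 z≤n) (eg 0 z≤n)
  conv-≈ (suc n) ef eg = ≈-+ (≈-* (ef 0 z≤n) (eg (suc n) ℕₚ.≤-refl))
    (conv-≈ n (λ i i≤n → ef (suc i) (s≤s i≤n)) (λ i i≤n → eg i (ℕₚ.m≤n⇒m≤1+n i≤n)))

  p∤-* : ∀ a b → ¬ (p ℕ∣.∣ a) → ¬ (p ℕ∣.∣ b) → ¬ (p ℕ∣.∣ (a ℕ.* b))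
  p∤-* a b p∤a p∤b p∣ab with euclidsLemma a b p-prime p∣ab
  ... | inj₁ p∣a = p∤a p∣a
  ... | inj₂ p∣b = p∤b p∣b

  p∤-<p : ∀ i → 0 < i → i < p → ¬ (p ℕ∣.∣ i)
  p∤-<p (suc i) _ i<p = ℕ∣.>⇒∤ i<p

  p∤! : ∀ n → n < p → ¬ (p ℕ∣.∣ (n !))
  p∤! zero    _   p∣1 = ℕₚ.<⇒≢ 1<p (sym (ℕ∣.∣1⇒≡1 p∣1))
  p∤! (suc n) n<p = p∤-* (suc n) (n !) (p∤-<p (suc n) (s≤s z≤n) n<p) (p∤! n (ℕₚ.<-trans (ℕₚ.n<1+n n) n<p))

  ≈-cancelˡ : ∀ a {x y} → ¬ (p ℕ∣.∣ a) → + a * x ≈ + a * y → x ≈ y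
  ≈-cancelˡ a {x} {y} p∤a (mk≈ d) with euclidsLemma a ℤ.∣ x - y ∣ p-prime
    (subst (p ℕ∣.∣_) (ℤₚ.abs-* (+ a) (x - y)) (ℤ∣ₛ.∣⇒∣ᵤ (subst ((+ p) ℤ∣ₛ.∣_) (factor (+ a) x y) d)))
    where
    factor : ∀ a x y → a * x - a * y ≡ a * (x - y)
    factor = solve-∀
  ... | inj₁ p∣a   = ⊥-elim (p∤a p∣a)
  ... | inj₂ p∣x-y = mk≈ (ℤ∣ₛ.∣ᵤ⇒∣ p∣x-y)

module Horner (p : ℕ) where
  open import Data.Nat using (_+_; _*_; _^_)

  horner : (ℕ → ℕ) → ℕ → ℕ
  horner e zero    = 0
  horner e (suc G) = e 0 + p * horner (e ∘ suc) G

  dot : ℕ → (ℕ → ℕ) → (ℕ → ℕ) → ℕ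
  dot zero    X Y = 0
  dot (suc P) X Y = X 0 * Y 0 + dot P (X ∘ suc) (Y ∘ suc)

  convℕ : (ℕ → ℕ) → (ℕ → ℕ) → ℕ → ℕ
  convℕ a b m = dot (suc m) a (λ i → b (m ∸ i))

  digits<p : ∀ {r} {a : ℕ → ℕ} → 0 < p → (∀ i → i ≤ r → a i < p) → (∀ i → r < i → a i ≡ 0) → ∀ i → a i < p
  digits<p {r} 0<p a<p a≡0 i with i ℕₚ.≤? r
  ... | yes i≤r = a<p i i≤r
  ... | no  i≰r = subst (_< p) (sym (a≡0 i (ℕₚ.≰⇒> i≰r))) 0<p

  horner-cong : ∀ G {f g : ℕ → ℕ} → (∀ i → f i ≡ g i) → horner f G ≡ horner g G
  horner-cong zero    e = refl
  horner-cong (suc G) e = cong₂ (λ u v → u + p * v) (e 0) (horner-cong G (e ∘ suc))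

  horner-+ : ∀ G (f g : ℕ → ℕ) → horner (λ i → f i + g i) G ≡ horner f G + horner g G
  horner-+ zero    f g = refl
  horner-+ (suc G) f g =
    trans (cong (λ v → f 0 + g 0 + p * v) (horner-+ G (f ∘ suc) (g ∘ suc))) (regroup (f 0) (g 0) p _ _)
    where
    regroup : ∀ a b p x y → a + b + p * (x + y) ≡ a + p * x + (b + p * y)
    regroup = ℕ-Solver.solve-∀

  horner-*ˡ : ∀ G c (f : ℕ → ℕ) → horner (λ i → c * f i) G ≡ c * horner f G
  horner-*ˡ zero    c f = sym (ℕₚ.*-zeroʳ c)
  horner-*ˡ (suc G) c f = trans (cong (λ v → c * f 0 + p * v) (horner-*ˡ G c (f ∘ suc))) (factor c (f 0) p _)
    where
    factor : ∀ c a p x → c * a + p * (c * x) ≡ c * (a + p * x)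
    factor = ℕ-Solver.solve-∀

  horner-zero : ∀ G {f : ℕ → ℕ} → (∀ i → f i ≡ 0) → horner f G ≡ 0
  horner-zero zero    e = refl
  horner-zero (suc G) e = trans (cong₂ (λ u v → u + p * v) (e 0) (horner-zero G (e ∘ suc))) (ℕₚ.*-zeroʳ p)

  horner-truncate : ∀ G d {f : ℕ → ℕ} → (∀ i → G ≤ i → f i ≡ 0) → horner f (G + d) ≡ horner f G
  horner-truncate zero    d     e = horner-zero d (λ i → e i z≤n)
  horner-truncate (suc G) d {f} e = cong (λ v → f 0 + p * v) (horner-truncate G d (λ i G≤i → e (suc i) (s≤s G≤i)))

  horner-suc : ∀ G (f : ℕ → ℕ) → horner f (suc G) ≡ horner f G + f G * p ^ G
  horner-suc zero    f = trans (cong (_+_ (f 0)) (ℕₚ.*-zeroʳ p))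
      (trans (ℕₚ.+-identityʳ (f 0)) (sym (ℕₚ.*-identityʳ (f 0))))
  horner-suc (suc G) f = trans (cong (λ v → f 0 + p * v) (horner-suc G (f ∘ suc)))
    (regroup (f 0) p (horner (f ∘ suc) G) (f (suc G)) (p ^ G))
    where
    regroup : ∀ a p x c q → a + p * (x + c * q) ≡ a + p * x + c * (p * q)
    regroup = ℕ-Solver.solve-∀

  Σ≤≡horner : ∀ n (f : ℕ → ℕ) → Σ≤ n (λ i → f i * p ^ i) ≡ horner f (suc n)
  Σ≤≡horner zero    f = sym (horner-suc 0 f)
  Σ≤≡horner (suc n) f = trans (cong (_+ f (suc n) * p ^ suc n) (Σ≤≡horner n f)) (sym (horner-suc (suc n) f))

  dot-zeroˡ : ∀ P (X Y : ℕ → ℕ) → (∀ i → X i ≡ 0) → dot P X Y ≡ 0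
  dot-zeroˡ zero    X Y e = refl
  dot-zeroˡ (suc P) X Y e = cong₂ (λ u v → u * Y 0 + v) (e 0) (dot-zeroˡ P (X ∘ suc) (Y ∘ suc) (e ∘ suc))

  horner-convℕ-suc : ∀ G (a b : ℕ → ℕ) →
    horner (convℕ a b) (suc G) ≡ a 0 * horner b (suc G) + p * horner (convℕ (a ∘ suc) b) G
  horner-convℕ-suc G a b = trans (cong (λ v → a 0 * b 0 + 0 + p * v)
      (trans (horner-+ G (λ i → a 0 * b (suc i)) (convℕ (a ∘ suc) b))
        (cong (_+ horner (convℕ (a ∘ suc) b) G) (horner-*ˡ G (a 0) (b ∘ suc)))))
    (regroup (a 0) (b 0) p (horner (b ∘ suc) G) (horner (convℕ (a ∘ suc) b) G))
    where
    regroup : ∀ a b p x y → a * b + 0 + p * (a * x + y) ≡ a * (b + p * x) + p * y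
    regroup = ℕ-Solver.solve-∀

  horner-convℕ : ∀ r (a b : ℕ → ℕ) G → (∀ i → r < i → a i ≡ 0) → (∀ i → G ≤ i → b i ≡ 0) →
    horner (convℕ a b) (r + G) ≡ horner a (suc r) * horner b G
  horner-convℕ zero    a b G a≡0 b≡0 = begin
      horner (convℕ a b) G
    ≡⟨ horner-cong G only-a₀ ⟩
      horner (λ m → a 0 * b m) G
    ≡⟨ horner-*ˡ G (a 0) b ⟩
      a 0 * horner b G
    ≡⟨ cong (_* horner b G) (trans (cong (_+_ (a 0)) (ℕₚ.*-zeroʳ p)) (ℕₚ.+-identityʳ (a 0))) ⟨
      horner a 1 * horner b G
    ∎
    where
    open ≡-Reasoning
    only-a₀ : ∀ m → convℕ a b m ≡ a 0 * b m
    only-a₀ zero    = ℕₚ.+-identityʳ _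
    only-a₀ (suc m) = trans (cong (_+_ (a 0 * b (suc m)))
      (dot-zeroˡ (suc m) (a ∘ suc) (λ i → b (suc m ∸ suc i)) (λ i → a≡0 (suc i) (s≤s z≤n)))) (ℕₚ.+-identityʳ _)
  horner-convℕ (suc r) a b G a≡0 b≡0 = begin
      horner (convℕ a b) (suc (r + G))
    ≡⟨ horner-convℕ-suc (r + G) a b ⟩
      a 0 * horner b (suc (r + G)) + p * horner (convℕ (a ∘ suc) b) (r + G)
    ≡⟨ cong₂ (λ u v → a 0 * u + p * v) b-tail (horner-convℕ r (a ∘ suc) b G (λ i r<i → a≡0 (suc i) (s≤s r<i)) b≡0) ⟩
      a 0 * horner b G + p * (horner (a ∘ suc) (suc r) * horner b G)
    ≡⟨ factor (a 0) p (horner (a ∘ suc) (suc r)) (horner b G) ⟩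
      horner a (suc (suc r)) * horner b G
    ∎
    where
    open ≡-Reasoning
    b-tail : horner b (suc (r + G)) ≡ horner b G
    b-tail = trans (cong (horner b) (trans (cong suc (ℕₚ.+-comm r G)) (sym (ℕₚ.+-suc G r))))
        (horner-truncate G (suc r) b≡0)
    factor : ∀ a p x y → a * y + p * (x * y) ≡ (a + p * x) * y
    factor = ℕ-Solver.solve-∀

module BinomialModP (p : ℕ) (p-prime : Prime p) where
  open import Data.Integer using (_+_; _*_; _^_)
  open Series
  open Congruence p p-prime
  open Horner p

  p∣choose-p : ∀ i → 0 < i → i < p → p ℕ∣.∣ choose p i
  p∣choose-p (suc k) _ k<p with euclidsLemma (suc k) (choose p (suc k)) p-prime
    (subst (p ℕ∣.∣_) (sym absorb) (ℕ∣.m∣m*n (choose (p ∸ 1) k)))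
    where
    absorb : suc k ℕ.* choose p (suc k) ≡ p ℕ.* choose (p ∸ 1) k
    absorb = subst (λ q → suc k ℕ.* choose q (suc k) ≡ q ℕ.* choose (p ∸ 1) k) suc[p∸1]≡p (choose-absorb (p ∸ 1) k)
  ... | inj₁ p∣k+1 = ⊥-elim (p∤-<p (suc k) (s≤s z≤n) k<p p∣k+1)
  ... | inj₂ p∣C   = p∣C

  binom-p≈ : ∀ i → binom p i ≈ δ 0 i + δ p i
  binom-p≈ zero    = ≡⇒≈ (cong (_+_ (+ 1)) (sym (δ-≢ p 0 (ℕₚ.>⇒≢ 0<p))))
  binom-p≈ (suc k) with ℕₚ.<-cmp (suc k) p
  ... | tri< k<p _ _ = ≈-trans (p∣n⇒n≈0 (p∣choose-p (suc k) (s≤s z≤n) k<p))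
    (≡⇒≈ (sym (trans (ℤₚ.+-identityˡ _) (δ-≢ p (suc k) (λ e → ℕₚ.<⇒≢ k<p (sym e))))))
  ... | tri≈ _ refl _ = ≡⇒≈ (trans (cong +_ (choose-n-n p)) (sym (trans (ℤₚ.+-identityˡ _) (δ-refl p))))
  ... | tri> _ _ p<k = ≡⇒≈ (trans (cong +_ (n<k⇒choose≡0 p (suc k) p<k))
    (sym (trans (ℤₚ.+-identityˡ _) (δ-≢ p (suc k) (ℕₚ.<⇒≢ p<k)))))

  binom-p*-suc : ∀ Z N → binom (p ℕ.* suc Z) N ≈ conv (δ 0) (binom (p ℕ.* Z)) N + conv (δ p) (binom (p ℕ.* Z)) N
  binom-p*-suc Z N = begin
      binom (p ℕ.* suc Z) N
    ≡⟨ trans (cong (λ q → binom q N) (ℕₚ.*-suc p Z)) (vandermonde p (p ℕ.* Z) N) ⟩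
      conv (binom p) (binom (p ℕ.* Z)) N
    ≈⟨ conv-≈ N (λ i _ → binom-p≈ i) (λ _ _ → ≈-refl) ⟩
      conv (λ i → δ 0 i + δ p i) (binom (p ℕ.* Z)) N
    ≡⟨ conv-+ˡ (δ 0) (δ p) (binom (p ℕ.* Z)) N ⟩
      conv (δ 0) (binom (p ℕ.* Z)) N + conv (δ p) (binom (p ℕ.* Z)) N
    ∎
    where open ≈-Reasoning

  binom-p*-p* : ∀ Z q → binom (p ℕ.* Z) (p ℕ.* q) ≈ binom Z q
  binom-p*-p* zero q rewrite ℕₚ.*-zeroʳ p with q
  ... | zero rewrite ℕₚ.*-zeroʳ p = ≈-refl
  ... | suc q′ = ≡⇒≈ (cong +_ (n<k⇒choose≡0 0 (p ℕ.* suc q′) (ℕₚ.<-≤-trans 0<p (ℕₚ.m≤m*n p (suc q′)))))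
  binom-p*-p* (suc Z) zero rewrite ℕₚ.*-zeroʳ p = ≈-trans (binom-p*-suc Z 0)
    (≡⇒≈ (cong₂ _+_ (conv-δ 0 (binom (p ℕ.* Z)) 0 z≤n) (conv-δ-< p (binom (p ℕ.* Z)) 0 0<p)))
  binom-p*-p* (suc Z) (suc q) = begin
      binom (p ℕ.* suc Z) N
    ≈⟨ binom-p*-suc Z N ⟩
      conv (δ 0) (binom (p ℕ.* Z)) N + conv (δ p) (binom (p ℕ.* Z)) N
    ≡⟨ cong₂ _+_ (conv-δ 0 (binom (p ℕ.* Z)) N z≤n) (trans (conv-δ p (binom (p ℕ.* Z)) N (ℕₚ.m≤m*n p (suc q)))
         (cong (binom (p ℕ.* Z)) N∸p)) ⟩
      binom (p ℕ.* Z) (p ℕ.* suc q) + binom (p ℕ.* Z) (p ℕ.* q)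
    ≈⟨ ≈-+ (binom-p*-p* Z (suc q)) (binom-p*-p* Z q) ⟩
      binom Z (suc q) + binom Z q
    ≡⟨ trans (ℤₚ.+-comm (binom Z (suc q)) (binom Z q)) (sym (ℤₚ.pos-+ (choose Z q) (choose Z (suc q)))) ⟩
      binom (suc Z) (suc q)
    ∎
    where
    open ≈-Reasoning
    N = p ℕ.* suc q
    N∸p : N ∸ p ≡ p ℕ.* q
    N∸p = trans (cong (_∸ p) (ℕₚ.*-suc p q)) (ℕₚ.m+n∸m≡n p (p ℕ.* q))

  binom-p*-∤ : ∀ Z n → ¬ (p ℕ∣.∣ n) → binom (p ℕ.* Z) n ≈ + 0
  binom-p*-∤ zero n p∤n rewrite ℕₚ.*-zeroʳ p with n
  ... | zero   = ⊥-elim (p∤n (p ℕ∣.∣0))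
  ... | suc n′ = ≈-refl
  binom-p*-∤ (suc Z) n p∤n = ≈-trans (binom-p*-suc Z n) (≈-+ unshifted shifted)
    where
    unshifted : conv (δ 0) (binom (p ℕ.* Z)) n ≈ + 0
    unshifted = ≈-trans (≡⇒≈ (conv-δ 0 (binom (p ℕ.* Z)) n z≤n)) (binom-p*-∤ Z n p∤n)
    shifted : conv (δ p) (binom (p ℕ.* Z)) n ≈ + 0
    shifted with p ℕₚ.≤? n
    ... | yes p≤n = ≈-trans (≡⇒≈ (conv-δ p (binom (p ℕ.* Z)) n p≤n))
      (binom-p*-∤ Z (n ∸ p) (λ p∣n∸p → p∤n (ℕ∣.∣m∸n∣n⇒∣m p p≤n p∣n∸p ℕ∣.∣-refl)))
    ... | no p≰n  = ≡⇒≈ (conv-δ-< p (binom (p ℕ.* Z)) n (ℕₚ.≰⇒> p≰n))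

  binom-p^m*-low : ∀ m Y N → N < p ℕ.^ m → binom (p ℕ.^ m ℕ.* Y) N ≈ δ 0 N
  binom-p^m*-low zero    Y zero    _          = ≈-refl
  binom-p^m*-low zero    Y (suc N) (s≤s ())
  binom-p^m*-low (suc m) Y N       N<p^[1+m] with p ℕ∣.∣? N
  ... | yes (ℕ∣.divides q N≡q*p) = begin
      binom (p ℕ.* p ℕ.^ m ℕ.* Y) N
    ≡⟨ cong₂ binom (ℕₚ.*-assoc p (p ℕ.^ m) Y) (trans N≡q*p (ℕₚ.*-comm q p)) ⟩
      binom (p ℕ.* (p ℕ.^ m ℕ.* Y)) (p ℕ.* q)
    ≈⟨ binom-p*-p* (p ℕ.^ m ℕ.* Y) q ⟩
      binom (p ℕ.^ m ℕ.* Y) q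
    ≈⟨ binom-p^m*-low m Y q q<p^m ⟩
      δ 0 q
    ≡⟨ δ-cong⇔ (λ e → sym (trans N≡q*p (cong (ℕ._* p) (sym e)))) (λ e → ℕₚ.*-cancelʳ-≡ 0 q p (trans e N≡q*p)) ⟩
      δ 0 N
    ∎
    where
    open ≈-Reasoning
    q<p^m : q < p ℕ.^ m
    q<p^m = ℕₚ.*-cancelʳ-< p q (p ℕ.^ m)
      (subst (ℕ._< p ℕ.^ m ℕ.* p) N≡q*p (subst (N <_) (ℕₚ.*-comm p (p ℕ.^ m)) N<p^[1+m]))
  ... | no p∤N = ≈-trans (≡⇒≈ (cong (λ z → binom z N) (ℕₚ.*-assoc p (p ℕ.^ m) Y)))
    (≈-trans (binom-p*-∤ (p ℕ.^ m ℕ.* Y) N p∤N) (≡⇒≈ (sym (δ-≢ 0 N (λ e → p∤N (subst (p ℕ∣.∣_) e (p ℕ∣.∣0)))))))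

  horner≈head : ∀ e G → + horner e (suc G) ≈ + e 0
  horner≈head e G = ≈-trans (≡⇒≈ (ℤₚ.pos-+ (e 0) _))
    (≈-trans (≈-+ (≈-refl {+ e 0}) (p∣n⇒n≈0 (ℕ∣.m∣m*n (horner (e ∘ suc) G)))) (≡⇒≈ (ℤₚ.+-identityʳ _)))

  horner*horner≈head : ∀ a b r s → + (horner a (suc r) ℕ.* horner b (suc s)) ≈ + (a 0 ℕ.* b 0)
  horner*horner≈head a b r s = ≈-trans (≡⇒≈ (ℤₚ.pos-* (horner a (suc r)) _))
    (≈-trans (≈-* (horner≈head a r) (horner≈head b s)) (≡⇒≈ (sym (ℤₚ.pos-* (a 0) (b 0)))))

  frobenius-substitution : {A : Set} (L : List A) (coeff : A → ℤ) (W : A → ℕ) (c : ℕ) →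
    (∀ q → ΣL L (λ l → coeff l * δ (W l) q) ≈ binom c q) →
    ∀ e n → ΣL L (λ l → coeff l * δ (W l ℕ.* p ℕ.^ e) n) ≈ binom (p ℕ.^ e ℕ.* c) n
  frobenius-substitution L coeff W c H zero n =
    ≈-trans (≡⇒≈ (ΣL-cong L (λ l → cong (λ z → coeff l * δ z n) (ℕₚ.*-identityʳ (W l)))))
      (≈-trans (H n) (≡⇒≈ (cong (λ z → binom z n) (sym (ℕₚ.*-identityˡ c)))))
  frobenius-substitution L coeff W c H (suc e) n with p ℕ∣.∣? n
  ... | yes (ℕ∣.divides q n≡q*p) = begin
      ΣL L (λ l → coeff l * δ (W l ℕ.* p ℕ.^ suc e) n)
    ≡⟨ ΣL-cong L (λ l → cong (coeff l *_) (δ-cong⇔ (divide l) (multiply l))) ⟩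
      ΣL L (λ l → coeff l * δ (W l ℕ.* p ℕ.^ e) q)
    ≈⟨ frobenius-substitution L coeff W c H e q ⟩
      binom (p ℕ.^ e ℕ.* c) q
    ≈⟨ binom-p*-p* (p ℕ.^ e ℕ.* c) q ⟨
      binom (p ℕ.* (p ℕ.^ e ℕ.* c)) (p ℕ.* q)
    ≡⟨ cong₂ binom (sym (ℕₚ.*-assoc p (p ℕ.^ e) c)) (trans (ℕₚ.*-comm p q) (sym n≡q*p)) ⟩
      binom (p ℕ.^ suc e ℕ.* c) n
    ∎
    where
    open ≈-Reasoning
    reassoc : ∀ w → w ℕ.* p ℕ.^ suc e ≡ w ℕ.* p ℕ.^ e ℕ.* p
    reassoc w = trans (cong (w ℕ.*_) (ℕₚ.*-comm p (p ℕ.^ e))) (sym (ℕₚ.*-assoc w (p ℕ.^ e) p))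
    divide : ∀ l → W l ℕ.* p ℕ.^ suc e ≡ n → W l ℕ.* p ℕ.^ e ≡ q
    divide l h = ℕₚ.*-cancelʳ-≡ _ q p (trans (sym (reassoc (W l))) (trans h n≡q*p))
    multiply : ∀ l → W l ℕ.* p ℕ.^ e ≡ q → W l ℕ.* p ℕ.^ suc e ≡ n
    multiply l h = trans (reassoc (W l)) (trans (cong (ℕ._* p) h) (sym n≡q*p))
  ... | no p∤n = ≈-trans (≡⇒≈ (trans (ΣL-cong L vanish) (ΣL-zero L)))
    (≈-sym (≈-trans (≡⇒≈ (cong (λ z → binom z n) (ℕₚ.*-assoc p (p ℕ.^ e) c))) (binom-p*-∤ (p ℕ.^ e ℕ.* c) n p∤n)))
    where
    vanish : ∀ l → coeff l * δ (W l ℕ.* p ℕ.^ suc e) n ≡ + 0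
    vanish l = trans (cong (coeff l *_)
        (δ-≢ _ n (λ h → p∤n (subst (p ℕ∣.∣_) h (ℕ∣.∣n⇒∣m*n (W l) (ℕ∣.m∣m*n (p ℕ.^ e)))))))
      (ℤₚ.*-zeroʳ (coeff l))

  lucas-step : ∀ t e Z → e < p → binom (e ℕ.+ p ℕ.* Z) (p ℕ.^ suc t) ≈ binom Z (p ℕ.^ t)
  lucas-step t e Z e<p = begin
      binom (e ℕ.+ p ℕ.* Z) N
    ≡⟨ trans (vandermonde e (p ℕ.* Z) N) (conv≡Σ< (binom e) (binom (p ℕ.* Z)) N) ⟩
      Σ< (suc N) (λ i → binom e i * binom (p ℕ.* Z) (N ∸ i))
    ≈⟨ Σ<-≈ (suc N) only-i≡0 ⟩
      Σ< (suc N) (λ i → δ 0 i * binom (p ℕ.* Z) (N ∸ i))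
    ≡⟨ Σ<-δ (suc N) 0 (λ i → binom (p ℕ.* Z) (N ∸ i)) (s≤s z≤n) ⟩
      binom (p ℕ.* Z) (p ℕ.* p ℕ.^ t)
    ≈⟨ binom-p*-p* Z (p ℕ.^ t) ⟩
      binom Z (p ℕ.^ t)
    ∎
    where
    open ≈-Reasoning
    N = p ℕ.^ suc t
    p≤N : p ≤ N
    p≤N = ℕₚ.m≤m*n p (p ℕ.^ t) {{ℕ.>-nonZero (ℕₚ.m^n>0 p t)}}
    only-i≡0 : ∀ i → i < suc N → binom e i * binom (p ℕ.* Z) (N ∸ i) ≈ δ 0 i * binom (p ℕ.* Z) (N ∸ i)
    only-i≡0 zero    _ = ≈-refl
    only-i≡0 (suc k) _ with suc k ℕₚ.≤? e
    ... | no k≰e = ≡⇒≈ (cong (λ c → + c * binom (p ℕ.* Z) (N ∸ suc k)) (n<k⇒choose≡0 e (suc k) (ℕₚ.≰⇒> k≰e)))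
    ... | yes k≤e = ≈-trans (≈-* (≈-refl {binom e (suc k)}) (binom-p*-∤ Z (N ∸ suc k) p∤N∸k))
      (≡⇒≈ (ℤₚ.*-zeroʳ (binom e (suc k))))
      where
      k<p : suc k < p
      k<p = ℕₚ.≤-<-trans k≤e e<p
      p∤N∸k : ¬ (p ℕ∣.∣ (N ∸ suc k))
      p∤N∸k p∣N∸k = p∤-<p (suc k) (s≤s z≤n) k<p (ℕ∣.∣m+n∣m⇒∣n
        (subst (p ℕ∣.∣_) (sym (ℕₚ.m∸n+n≡m (ℕₚ.<⇒≤ (ℕₚ.<-≤-trans k<p p≤N)))) (ℕ∣.m∣m*n (p ℕ.^ t))) p∣N∸k)

  lucas-digit : ∀ t G (e : ℕ → ℕ) → t < G → (∀ i → i < G → e i < p) → binom (horner e G) (p ℕ.^ t) ≈ + e t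
  lucas-digit zero    (suc G) e _         _   = ≈-trans (≡⇒≈ (cong +_ (choose-n-1 _))) (horner≈head e G)
  lucas-digit (suc t) (suc G) e (s≤s t<G) e<p = ≈-trans (lucas-step t (e 0) (horner (e ∘ suc) G) (e<p 0 (s≤s z≤n)))
    (lucas-digit t G (e ∘ suc) t<G (λ i i<G → e<p (suc i) (s≤s i<G)))

  freshman : ∀ x → (x + + 1) ^ p ≈ x ^ p + + 1
  freshman x = begin
      (x + + 1) ^ p
    ≡⟨ binomial-theorem x p ⟩
      Σ< (suc p) (λ i → binom p i * x ^ i)
    ≈⟨ Σ<-≈ (suc p) (λ i _ → ≈-* (binom-p≈ i) (≈-refl {x ^ i})) ⟩
      Σ< (suc p) (λ i → (δ 0 i + δ p i) * x ^ i)
    ≡⟨ Σ<-cong (suc p) (λ i _ → ℤₚ.*-distribʳ-+ (x ^ i) (δ 0 i) (δ p i)) ⟩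
      Σ< (suc p) (λ i → δ 0 i * x ^ i + δ p i * x ^ i)
    ≡⟨ Σ<-+ (suc p) (λ i → δ 0 i * x ^ i) (λ i → δ p i * x ^ i) ⟩
      Σ< (suc p) (λ i → δ 0 i * x ^ i) + Σ< (suc p) (λ i → δ p i * x ^ i)
    ≡⟨ cong₂ _+_ (Σ<-δ (suc p) 0 (x ^_) (s≤s z≤n)) (Σ<-δ (suc p) p (x ^_) ℕₚ.≤-refl) ⟩
      + 1 + x ^ p
    ≡⟨ ℤₚ.+-comm (+ 1) (x ^ p) ⟩
      x ^ p + + 1
    ∎
    where open ≈-Reasoning

  fermat : ∀ d → (+ d) ^ p ≈ + d
  fermat zero    = ≡⇒≈ (subst (λ q → (+ 0) ^ q ≡ + 0) suc[p∸1]≡p refl)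
  fermat (suc d) = begin
      (+ suc d) ^ p
    ≡⟨ cong (_^ p) [1+d]≡d+1 ⟩
      (+ d + + 1) ^ p
    ≈⟨ freshman (+ d) ⟩
      (+ d) ^ p + + 1
    ≈⟨ ≈-+ (fermat d) ≈-refl ⟩
      + d + + 1
    ≡⟨ [1+d]≡d+1 ⟨
      + suc d
    ∎
    where
    open ≈-Reasoning
    [1+d]≡d+1 : + suc d ≡ + d + + 1
    [1+d]≡d+1 = trans (cong +_ (ℕₚ.+-comm 1 d)) (ℤₚ.pos-+ d 1)

  fermat-inverse : ∀ d → ¬ (p ℕ∣.∣ d) → + d * invₚ p (+ d) ≈ + 1
  fermat-inverse d p∤d = ≈-cancelˡ d p∤d (begin
      + d * (+ d * (+ d) ^ (p ∸ 2))
    ≡⟨ cong ((+ d) ^_) (trans (cong suc (sym (ℕₚ.+-∸-assoc 1 2≤p))) suc[p∸1]≡p) ⟩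
      (+ d) ^ p
    ≈⟨ fermat d ⟩
      + d
    ≡⟨ ℤₚ.*-identityʳ (+ d) ⟨
      + d * + 1
    ∎)
    where
    open ≈-Reasoning
    2≤p : 2 ≤ p
    2≤p = 1<p

-- The list constructions of Defs (boundedVecs, allSubsets, allTuples, ...) take p and ks as parameters without
-- using them.
module Multinomial (P : ℕ) (KS : List (Vec ℕ (P ∸ 1))) where
  open import Data.Integer using (_+_; _*_; _^_)
  open Series

  bounded : (n b : ℕ) → List (Vec ℕ n)
  bounded = boundedVecs P KS

  eqV : ∀ {n} → Vec ℕ n → Vec ℕ n → Bool
  eqV []       []       = true
  eqV (x ∷ xs) (y ∷ ys) = (x ≡ᵇ y) ∧ eqV xs ys

  eqV-refl : ∀ {n} (v : Vec ℕ n) → eqV v v ≡ true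
  eqV-refl []      = refl
  eqV-refl (x ∷ v) rewrite Equivalence.to Boolₚ.T-≡ (ℕₚ.≡⇒≡ᵇ x x refl) = eqV-refl v

  eqV-sym : ∀ {n} (u v : Vec ℕ n) → eqV u v ≡ eqV v u
  eqV-sym []      []      = refl
  eqV-sym (x ∷ u) (y ∷ v) = cong₂ _∧_ (≡ᵇ-sym x y) (eqV-sym u v)

  eqV⇒≡ : ∀ {n} (u v : Vec ℕ n) → eqV u v ≡ true → u ≡ v
  eqV⇒≡ []      []      _ = refl
  eqV⇒≡ (x ∷ u) (y ∷ v) e with x ≡ᵇ y in x≡ᵇy
  ... | true = cong₂ _∷_ (ℕₚ.≡ᵇ⇒≡ x y (Equivalence.from Boolₚ.T-≡ x≡ᵇy)) (eqV⇒≡ u v e)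

  ≢⇒eqV-false : ∀ {n} (u v : Vec ℕ n) → u ≢ v → eqV u v ≡ false
  ≢⇒eqV-false u v u≢v with eqV u v in e
  ... | true  = ⊥-elim (u≢v (eqV⇒≡ u v e))
  ... | false = refl

  eqV-false⇒≢ : ∀ {n} (u v : Vec ℕ n) → eqV u v ≡ false → u ≢ v
  eqV-false⇒≢ u .u e refl with () ← trans (sym (eqV-refl u)) e

  ΣL-bounded-suc : ∀ n b (F : Vec ℕ (suc n) → ℤ) →
    ΣL (bounded (suc n) b) F ≡ Σ< (suc b) (λ c → ΣL (bounded n (b ∸ c)) (λ l → F (c ∷ l)))
  ΣL-bounded-suc n b F = trans (ΣL-concatMap (λ c → map (c ∷_) (bounded n (b ∸ c))) (upTo (suc b)) F)
    (trans (ΣL-upTo (suc b) (λ c → ΣL (map (c ∷_) (bounded n (b ∸ c))) F))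
      (Σ<-cong (suc b) (λ c _ → ΣL-map (c ∷_) (bounded n (b ∸ c)) F)))

  module BoundedSumCong (R : ℤ → ℤ → Set) (R-+ : ∀ {a b c d} → R a b → R c d → R (a + c) (b + d))
                        (R-0 : R (+ 0) (+ 0)) where
    Σ<-congᴿ : ∀ n {f g : ℕ → ℤ} → (∀ i → i < n → R (f i) (g i)) → R (Σ< n f) (Σ< n g)
    Σ<-congᴿ zero    e = R-0
    Σ<-congᴿ (suc n) e = R-+ (e 0 (s≤s z≤n)) (Σ<-congᴿ n (λ i i<n → e (suc i) (s≤s i<n)))

    ΣL-bounded-congᴿ : ∀ n b {f g : Vec ℕ n → ℤ} → (∀ v → Vec.sum v ≤ b → R (f v) (g v)) →
      R (ΣL (bounded n b) f) (ΣL (bounded n b) g)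
    ΣL-bounded-congᴿ zero    b e = R-+ (e [] z≤n) R-0
    ΣL-bounded-congᴿ (suc n) b {f} {g} e = subst₂ R (sym (ΣL-bounded-suc n b f)) (sym (ΣL-bounded-suc n b g))
      (Σ<-congᴿ (suc b) (λ c c<1+b → ΣL-bounded-congᴿ n (b ∸ c) (λ l sum≤ → e (c ∷ l)
         (subst (c ℕ.+ Vec.sum l ≤_) (ℕₚ.m+[n∸m]≡n (ℕₚ.≤-pred c<1+b)) (ℕₚ.+-monoʳ-≤ c sum≤)))))

  ΣL-bounded-cong : ∀ n b {f g : Vec ℕ n → ℤ} → (∀ v → Vec.sum v ≤ b → f v ≡ g v) →
    ΣL (bounded n b) f ≡ ΣL (bounded n b) g
  ΣL-bounded-cong = BoundedSumCong.ΣL-bounded-congᴿ _≡_ (cong₂ _+_) refl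

  ΣL-bounded-eqV : ∀ n b (v : Vec ℕ n) (g : Vec ℕ n → ℤ) → Vec.sum v ≤ b →
    ΣL (bounded n b) (λ l → if eqV v l then g l else + 0) ≡ g v
  ΣL-bounded-eqV zero    b []        g _     = ℤₚ.+-identityʳ (g [])
  ΣL-bounded-eqV (suc n) b (x ∷ v) g sum≤b = begin
      ΣL (bounded (suc n) b) (λ l → if eqV (x ∷ v) l then g l else + 0)
    ≡⟨ ΣL-bounded-suc n b _ ⟩
      Σ< (suc b) (λ c → ΣL (bounded n (b ∸ c)) (λ l → if (x ≡ᵇ c) ∧ eqV v l then g (c ∷ l) else + 0))
    ≡⟨ Σ<-cong (suc b) (λ c _ → split-head c) ⟩
      Σ< (suc b) (λ c → δ x c * ΣL (bounded n (b ∸ c)) (λ l → if eqV v l then g (c ∷ l) else + 0))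
    ≡⟨ Σ<-δ (suc b) x (λ c → ΣL (bounded n (b ∸ c)) (λ l → if eqV v l then g (c ∷ l) else + 0))
         (s≤s (ℕₚ.≤-trans (ℕₚ.m≤m+n x (Vec.sum v)) sum≤b)) ⟩
      ΣL (bounded n (b ∸ x)) (λ l → if eqV v l then g (x ∷ l) else + 0)
    ≡⟨ ΣL-bounded-eqV n (b ∸ x) v (g ∘ (x ∷_)) (subst (_≤ b ∸ x) (ℕₚ.m+n∸m≡n x (Vec.sum v)) (ℕₚ.∸-monoˡ-≤ x sum≤b)) ⟩
      g (x ∷ v)
    ∎
    where
    open ≡-Reasoning
    split-head : ∀ c → ΣL (bounded n (b ∸ c)) (λ l → if (x ≡ᵇ c) ∧ eqV v l then g (c ∷ l) else + 0)
                     ≡ δ x c * ΣL (bounded n (b ∸ c)) (λ l → if eqV v l then g (c ∷ l) else + 0)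
    split-head c with x ≡ᵇ c
    ... | true  = sym (ℤₚ.*-identityˡ _)
    ... | false = ΣL-zero (bounded n (b ∸ c))

  multinomial : ∀ {L} → ℕ → Vec ℕ L → ℕ
  multinomial y []      = 1
  multinomial y (c ∷ v) = choose y c ℕ.* multinomial (y ∸ c) v

  decAt : ∀ {n} → Vec ℕ n → Fin n → Vec ℕ n
  decAt (c ∷ v) Fin.zero    = ℕ.pred c ∷ v
  decAt (c ∷ v) (Fin.suc l) = c ∷ decAt v l

  incAt : ∀ {n} → Vec ℕ n → Fin n → Vec ℕ n
  incAt (c ∷ v) Fin.zero    = suc c ∷ v
  incAt (c ∷ v) (Fin.suc l) = c ∷ incAt v l

  positive : ℕ → ℤ
  positive zero    = + 0
  positive (suc _) = + 1

  y∸c≡suc : ∀ {y c} → c < y → y ∸ c ≡ suc (y ∸ suc c)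
  y∸c≡suc {suc y} {zero}  _         = refl
  y∸c≡suc {suc y} {suc c} (s≤s c<y) = y∸c≡suc c<y

  multinomialℤ : ∀ {L} → ℕ → Vec ℕ L → ℤ
  multinomialℤ y v = + multinomial y v

  decSum : ∀ {L} → ℕ → Vec ℕ L → ℤ
  decSum {L} y v = ΣFin L (λ l → positive (lookup v l) * + multinomial y (decAt v l))

  multinomial-pascal-∷ : ∀ {L} y c (v : Vec ℕ L) →
      (∀ y′ → + multinomial (suc y′) v ≡ + multinomial y′ v + decSum y′ v) →
    binom (suc y) c * multinomialℤ (suc y ∸ c) v ≡ binom y c * multinomialℤ (y ∸ c) v +
        (positive c * + multinomial y (ℕ.pred c ∷ v) + binom y c * decSum (y ∸ c) v)
  multinomial-pascal-∷ y zero     v pascal = trans (cong (+ 1 *_) (pascal y))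
      (regroup (multinomialℤ y v) (decSum y v) (+ multinomial y (0 ∷ v)))
    where
    regroup : ∀ a b d → + 1 * (a + b) ≡ + 1 * a + (+ 0 * d + + 1 * b)
    regroup = solve-∀
  multinomial-pascal-∷ y (suc c) v pascal with c ℕₚ.<? y
  ... | yes c<y = begin
      binom (suc y) (suc c) * multinomialℤ (y ∸ c) v
    ≡⟨ cong₂ _*_ (ℤₚ.pos-+ (choose y c) _) M[y∸c] ⟩
      (A + B) * (multinomialℤ y′ v + decSum y′ v)
    ≡⟨ regroup A B (multinomialℤ y′ v) (decSum y′ v) ⟩
      B * multinomialℤ y′ v + (+ 1 * (A * (multinomialℤ y′ v + decSum y′ v)) + B * decSum y′ v)
    ≡⟨ cong (λ m → B * multinomialℤ y′ v + (+ 1 * m + B * decSum y′ v))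
         (trans (ℤₚ.pos-* (choose y c) _) (cong (A *_) M[y∸c])) ⟨
      B * multinomialℤ y′ v + (+ 1 * + multinomial y (c ∷ v) + B * decSum y′ v)
    ∎
    where
    open ≡-Reasoning
    A B : ℤ
    A = binom y c
    B = binom y (suc c)
    y′ = y ∸ suc c
    M[y∸c] : multinomialℤ (y ∸ c) v ≡ multinomialℤ y′ v + decSum y′ v
    M[y∸c] = trans (cong (λ z → multinomialℤ z v) (y∸c≡suc c<y)) (pascal y′)
    regroup : ∀ a b m s → (a + b) * (m + s) ≡ b * m + (+ 1 * (a * (m + s)) + b * s)
    regroup = solve-∀
  ... | no c≮y = begin
      binom (suc y) (suc c) * multinomialℤ (y ∸ c) v
    ≡⟨ cong (_* multinomialℤ (y ∸ c) v) (trans (ℤₚ.pos-+ (choose y c) _) (cong (λ b → A + + b) B≡0)) ⟩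
      (A + + 0) * multinomialℤ (y ∸ c) v
    ≡⟨ regroup A (multinomialℤ (y ∸ c) v) (multinomialℤ y′ v) (decSum y′ v) ⟩
      + 0 * multinomialℤ y′ v + (+ 1 * (A * multinomialℤ (y ∸ c) v) + + 0 * decSum y′ v)
    ≡⟨ cong₂ (λ b m → b * multinomialℤ y′ v + (+ 1 * m + b * decSum y′ v)) (cong +_ B≡0) (ℤₚ.pos-* (choose y c) _) ⟨
      binom y (suc c) * multinomialℤ y′ v + (+ 1 * + multinomial y (c ∷ v) + binom y (suc c) * decSum y′ v)
    ∎
    where
    open ≡-Reasoning
    A : ℤ
    A = binom y c
    y′ = y ∸ suc c
    B≡0 : choose y (suc c) ≡ 0
    B≡0 = n<k⇒choose≡0 y (suc c) (s≤s (ℕₚ.≮⇒≥ c≮y))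
    regroup : ∀ a m m′ s → (a + + 0) * m ≡ + 0 * m′ + (+ 1 * (a * m) + + 0 * s)
    regroup = solve-∀

  multinomial-pascal : ∀ {L} y (v : Vec ℕ L) → + multinomial (suc y) v ≡ + multinomial y v + decSum y v
  multinomial-pascal y [] = refl
  multinomial-pascal {suc L} y (c ∷ v) = begin
      + (choose (suc y) c ℕ.* multinomial (suc y ∸ c) v)
    ≡⟨ ℤₚ.pos-* (choose (suc y) c) _ ⟩
      binom (suc y) c * multinomialℤ (suc y ∸ c) v
    ≡⟨ multinomial-pascal-∷ y c v (λ y′ → multinomial-pascal y′ v) ⟩
      binom y c * multinomialℤ (y ∸ c) v + (positive c * + multinomial y (ℕ.pred c ∷ v) + binom y c * decSum (y ∸ c) v)
    ≡⟨ cong₂ (λ a b → a + (positive c * + multinomial y (ℕ.pred c ∷ v) + b)) (sym (ℤₚ.pos-* (choose y c) _))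
         (sym decSum-∷) ⟩
      + multinomial y (c ∷ v) + decSum y (c ∷ v)
    ∎
    where
    open ≡-Reasoning
    decSum-∷ : ΣFin L (λ l → positive (lookup v l) * +
        (choose y c ℕ.* multinomial (y ∸ c) (decAt v l))) ≡ binom y c * decSum (y ∸ c) v
    decSum-∷ = trans (ΣFin-cong L (λ l → trans (cong (positive (lookup v l) *_) (ℤₚ.pos-* (choose y c) _))
      (*-left-comm (positive (lookup v l)) (binom y c) _))) (ΣFin-*ˡ L (binom y c) _)

  weightedSum-decAt : ∀ {n} (w : Fin n → ℕ) (v : Vec ℕ n) l k → lookup v l ≡ suc k →
    ΣFinℕ n (λ j → w j ℕ.* lookup v j) ≡ w l ℕ.+ ΣFinℕ n (λ j → w j ℕ.* lookup (decAt v l) j)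
  weightedSum-decAt w (c ∷ v) Fin.zero    k refl =
    trans (cong (ℕ._+ ΣFinℕ _ (λ j → w (Fin.suc j) ℕ.* lookup v j)) (ℕₚ.*-suc (w Fin.zero) k))
        (ℕₚ.+-assoc (w Fin.zero) _ _)
  weightedSum-decAt w (c ∷ v) (Fin.suc l) k e =
    trans (cong (ℕ._+_ (w Fin.zero ℕ.* c)) (weightedSum-decAt (w ∘ Fin.suc) v l k e))
        (left-comm (w Fin.zero ℕ.* c) (w (Fin.suc l)) _)
    where
    left-comm : ∀ a b d → a ℕ.+ (b ℕ.+ d) ≡ b ℕ.+ (a ℕ.+ d)
    left-comm = ℕ-Solver.solve-∀

  powerProduct-decAt : ∀ {n} (a : Fin n → ℤ) (v : Vec ℕ n) l k → lookup v l ≡ suc k →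
    ΠFin n (λ j → a j ^ lookup v j) ≡ a l * ΠFin n (λ j → a j ^ lookup (decAt v l) j)
  powerProduct-decAt a (c ∷ v) Fin.zero    k refl = ℤₚ.*-assoc (a Fin.zero) _ _
  powerProduct-decAt a (c ∷ v) (Fin.suc l) k e    =
    trans (cong (a Fin.zero ^ c *_) (powerProduct-decAt (a ∘ Fin.suc) v l k e))
        (*-left-comm (a Fin.zero ^ c) (a (Fin.suc l)) _)

  sum-decAt : ∀ {n} (v : Vec ℕ n) l k → lookup v l ≡ suc k → Vec.sum v ≡ suc (Vec.sum (decAt v l))
  sum-decAt (c ∷ v) Fin.zero    k refl = refl
  sum-decAt (c ∷ v) (Fin.suc l) k e    = trans (cong (ℕ._+_ c) (sum-decAt v l k e)) (ℕₚ.+-suc c _)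

  sum-incAt : ∀ {n} (u : Vec ℕ n) l → Vec.sum (incAt u l) ≡ suc (Vec.sum u)
  sum-incAt (c ∷ u) Fin.zero    = refl
  sum-incAt (c ∷ u) (Fin.suc l) = trans (cong (ℕ._+_ c) (sum-incAt u l)) (ℕₚ.+-suc c _)

  eqV-incAt-zero : ∀ {n} (v u : Vec ℕ n) l → lookup v l ≡ 0 → eqV v (incAt u l) ≡ false
  eqV-incAt-zero (c ∷ v) (a ∷ u) Fin.zero    refl = refl
  eqV-incAt-zero (c ∷ v) (a ∷ u) (Fin.suc l) e    =
    trans (cong ((c ≡ᵇ a) ∧_) (eqV-incAt-zero v u l e)) (Boolₚ.∧-zeroʳ (c ≡ᵇ a))

  eqV-incAt-suc : ∀ {n} (v u : Vec ℕ n) l k → lookup v l ≡ suc k → eqV v (incAt u l) ≡ eqV (decAt v l) u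
  eqV-incAt-suc (c ∷ v) (a ∷ u) Fin.zero    k refl = refl
  eqV-incAt-suc (c ∷ v) (a ∷ u) (Fin.suc l) k e    = cong ((c ≡ᵇ a) ∧_) (eqV-incAt-suc v u l k e)

  multinomial-over : ∀ {L} y (v : Vec ℕ L) → y < Vec.sum v → multinomial y v ≡ 0
  multinomial-over y (c ∷ v) y<sum with y ℕₚ.<? c
  ... | yes y<c = cong (ℕ._* multinomial (y ∸ c) v) (n<k⇒choose≡0 y c y<c)
  ... | no y≮c  = trans (cong (choose y c ℕ.*_) (multinomial-over (y ∸ c) v y∸c<sum)) (ℕₚ.*-zeroʳ (choose y c))
    where
    y∸c<sum : y ∸ c < Vec.sum v
    y∸c<sum = ℕₚ.+-cancelˡ-< c (y ∸ c) (Vec.sum v)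
      (subst (_< c ℕ.+ Vec.sum v) (sym (ℕₚ.m+[n∸m]≡n (ℕₚ.≮⇒≥ y≮c))) y<sum)

  zeros : ∀ n → Vec ℕ n
  zeros n = Vec.replicate n 0

  sum-zeros : ∀ n → Vec.sum (zeros n) ≡ 0
  sum-zeros zero    = refl
  sum-zeros (suc n) = sum-zeros n

  multinomial-0 : ∀ {L} (v : Vec ℕ L) → + multinomial 0 v ≡ (if eqV (zeros L) v then + 1 else + 0)
  multinomial-0 []          = refl
  multinomial-0 (zero ∷ v)  = trans (cong +_ (ℕₚ.+-identityʳ (multinomial 0 v))) (multinomial-0 v)
  multinomial-0 (suc c ∷ v) = refl

  multinomial-zeros : ∀ L y → multinomial y (zeros L) ≡ 1
  multinomial-zeros zero    y = refl
  multinomial-zeros (suc L) y = trans (ℕₚ.+-identityʳ _) (multinomial-zeros L y)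

  weightedSum-zeros : ∀ n (w : Fin n → ℕ) → ΣFinℕ n (λ j → w j ℕ.* lookup (zeros n) j) ≡ 0
  weightedSum-zeros zero    w = refl
  weightedSum-zeros (suc n) w = cong₂ ℕ._+_ (ℕₚ.*-zeroʳ (w Fin.zero)) (weightedSum-zeros n (w ∘ Fin.suc))

  powerProduct-zeros : ∀ n (a : Fin n → ℤ) → ΠFin n (λ j → a j ^ lookup (zeros n) j) ≡ + 1
  powerProduct-zeros zero    a = refl
  powerProduct-zeros (suc n) a = trans (ℤₚ.*-identityˡ _) (powerProduct-zeros n (a ∘ Fin.suc))

  ΣL-bounded-shift : ∀ L b (l : Fin L) (H : Vec ℕ L → ℤ) → (∀ u → b ≤ Vec.sum u → H u ≡ + 0) →
    ΣL (bounded L b) (λ v → positive (lookup v l) * H (decAt v l)) ≡ ΣL (bounded L b) H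
  ΣL-bounded-shift L b l H H≡0 = sym (begin
      ΣL (bounded L b) H
    ≡⟨ ΣL-bounded-cong L b spread ⟩
      ΣL (bounded L b) (λ u → ΣL (bounded L b) (λ v → if eqV v (incAt u l) then H u else + 0))
    ≡⟨ ΣL-comm (bounded L b) (bounded L b) (λ u v → if eqV v (incAt u l) then H u else + 0) ⟩
      ΣL (bounded L b) (λ v → ΣL (bounded L b) (λ u → if eqV v (incAt u l) then H u else + 0))
    ≡⟨ ΣL-bounded-cong L b collect ⟩
      ΣL (bounded L b) (λ v → positive (lookup v l) * H (decAt v l))
    ∎)
    where
    open ≡-Reasoning
    spread : ∀ u → Vec.sum u ≤ b → H u ≡ ΣL (bounded L b) (λ v → if eqV v (incAt u l) then H u else + 0)
    spread u sum≤b with ℕₚ.m≤n⇒m<n∨m≡n sum≤b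
    ... | inj₁ sum<b = sym (trans (ΣL-cong (bounded L b)
        (λ v → cong (λ β → if β then H u else + 0) (eqV-sym v (incAt u l))))
                     (ΣL-bounded-eqV L b (incAt u l) (λ _ → H u) (subst (_≤ b) (sym (sum-incAt u l)) sum<b)))
    ... | inj₂ sum≡b = trans Hu≡0 (sym (trans (ΣL-cong (bounded L b)
                     (λ v → trans (cong (λ z → if eqV v (incAt u l) then z else + 0) Hu≡0) (Boolₚ.if-eta _)))
                         (ΣL-zero (bounded L b))))
      where
      Hu≡0 : H u ≡ + 0
      Hu≡0 = H≡0 u (ℕₚ.≤-reflexive (sym sum≡b))
    collect : ∀ v → Vec.sum v ≤ b →
      ΣL (bounded L b) (λ u → if eqV v (incAt u l) then H u else + 0) ≡ positive (lookup v l) * H (decAt v l)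
    collect v sum≤b with lookup v l in e
    ... | zero  = trans (ΣL-cong (bounded L b) (λ u → cong (λ β → if β then H u else + 0) (eqV-incAt-zero v u l e)))
                    (ΣL-zero (bounded L b))
    ... | suc k = trans (ΣL-cong (bounded L b) (λ u → cong (λ β → if β then H u else + 0) (eqV-incAt-suc v u l k e)))
                    (trans (ΣL-bounded-eqV L b (decAt v l) H
                        (ℕₚ.≤-trans (ℕₚ.n≤1+n _) (subst (_≤ b) (sum-decAt v l k e) sum≤b)))
                      (sym (ℤₚ.*-identityˡ _)))

  weight : ∀ {L} → Vec ℕ L → ℕ
  weight {L} v = ΣFinℕ L (λ j → suc (toℕ j) ℕ.* lookup v j)

  powerProduct : ∀ {L} → ℕ → Vec ℕ L → ℤ
  powerProduct {L} x v = ΠFin L (λ j → binom x (suc (toℕ j)) ^ lookup v j)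

  -- expansion y is the coefficient sequence of (1 + Σ_{1 ≤ j ≤ L} C(x,j) z^j)^y, expanded by the multinomial
  -- theorem; x ≤ L makes the base equal to (1 + z)^x, and y ≤ b makes bounded L b contain every exponent vector
  -- that contributes.
  module MultinomialTheorem (L b x : ℕ) (x≤L : x ≤ L) where
    term : ℕ → Vec ℕ L → ℕ → ℤ
    term y v n = δ (weight v) n * (+ multinomial y v * powerProduct x v)

    expansion : ℕ → ℕ → ℤ
    expansion y n = ΣL (bounded L b) (λ v → term y v n)

    monomial : Fin L → ℕ → ℤ
    monomial l j = binom x (suc (toℕ l)) * δ (suc (toℕ l)) j

    binom≡1+Σmonomial : ∀ j → binom x j ≡ δ 0 j + ΣFin L (λ l → monomial l j)
    binom≡1+Σmonomial zero    = sym (cong (_+_ (+ 1)) (ΣFin-zero L (λ l → ℤₚ.*-zeroʳ (binom x (suc (toℕ l))))))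
    binom≡1+Σmonomial (suc j) = sym (begin
        + 0 + ΣFin L (λ l → monomial l (suc j))
      ≡⟨ trans (ℤₚ.+-identityˡ _) (ΣFin≡Σ< L (λ i → binom x (suc i) * δ i j)) ⟩
        Σ< L (λ i → binom x (suc i) * δ i j)
      ≡⟨ Σ<-cong L (λ i _ → trans (ℤₚ.*-comm (binom x (suc i)) (δ i j)) (cong (_* binom x (suc i)) (δ-sym i j))) ⟩
        Σ< L (λ i → δ j i * binom x (suc i))
      ≡⟨ pick ⟩
        binom x (suc j)
      ∎)
      where
      open ≡-Reasoning
      pick : Σ< L (λ i → δ j i * binom x (suc i)) ≡ binom x (suc j)
      pick with j ℕₚ.<? L
      ... | yes j<L = Σ<-δ L j (λ i → binom x (suc i)) j<L
      ... | no j≮L  = trans (Σ<-vanishes) (sym (cong +_ (n<k⇒choose≡0 x (suc j) (s≤s (ℕₚ.≤-trans x≤L (ℕₚ.≮⇒≥ j≮L))))))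
        where
        Σ<-vanishes : Σ< L (λ i → δ j i * binom x (suc i)) ≡ + 0
        Σ<-vanishes = trans (Σ<-cong L {g = λ _ → + 0} (λ i i<L →
          trans (cong (_* binom x (suc i)) (δ-≢ j i (λ j≡i → j≮L (subst (_< L) (sym j≡i) i<L))))
              (ℤₚ.*-zeroˡ (binom x (suc i)))))
          (Σ<-zero L (λ _ → refl))

    expansion-0 : ∀ n → expansion 0 n ≡ δ 0 n
    expansion-0 n = begin
        expansion 0 n
      ≡⟨ ΣL-cong (bounded L b) only-zeros ⟩
        ΣL (bounded L b) (λ v → if eqV (zeros L) v then δ (weight v) n * powerProduct x v else + 0)
      ≡⟨ ΣL-bounded-eqV L b (zeros L) (λ v → δ (weight v) n * powerProduct x v) (subst (_≤ b) (sym (sum-zeros L)) z≤n) ⟩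
        δ (weight (zeros L)) n * powerProduct x (zeros L)
      ≡⟨ cong₂ (λ w c → δ w n * c) (weightedSum-zeros L (λ j → suc (toℕ j)))
           (powerProduct-zeros L (λ j → binom x (suc (toℕ j)))) ⟩
        δ 0 n * + 1
      ≡⟨ ℤₚ.*-identityʳ _ ⟩
        δ 0 n
      ∎
      where
      open ≡-Reasoning
      only-zeros : ∀ v → term 0 v n ≡ (if eqV (zeros L) v then δ (weight v) n * powerProduct x v else + 0)
      only-zeros v = trans (cong (λ z → δ (weight v) n * (z * powerProduct x v)) (multinomial-0 v))
          (select (eqV (zeros L) v))
        where
        select : ∀ β → δ (weight v) n * ((if β then + 1 else + 0) * powerProduct x v) ≡
                       (if β then δ (weight v) n * powerProduct x v else + 0)
        select true  = cong (δ (weight v) n *_) (ℤₚ.*-identityˡ _)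
        select false = ℤₚ.*-zeroʳ (δ (weight v) n)

    conv-monomial : ∀ y → suc y ≤ b → ∀ l n →
      ΣL (bounded L b) (λ v → δ (weight v) n * powerProduct x v * (positive (lookup v l) * + multinomial y (decAt v l)))
        ≡ conv (monomial l) (expansion y) n
    conv-monomial y 1+y≤b l n = begin
        ΣL (bounded L b) (λ v → δ (weight v) n * powerProduct x v *
            (positive (lookup v l) * + multinomial y (decAt v l)))
      ≡⟨ ΣL-cong (bounded L b) factor-out ⟩
        ΣL (bounded L b) (λ v → c * (positive (lookup v l) * shifted (decAt v l)))
      ≡⟨ ΣL-*ˡ (bounded L b) c (λ v → positive (lookup v l) * shifted (decAt v l)) ⟩
        c * ΣL (bounded L b) (λ v → positive (lookup v l) * shifted (decAt v l))
      ≡⟨ cong (c *_) (ΣL-bounded-shift L b l shifted shifted-over) ⟩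
        c * ΣL (bounded L b) shifted
      ≡⟨ cong (c *_) (ΣL-cong (bounded L b) shifted≡conv) ⟩
        c * ΣL (bounded L b) (λ u → conv (δ (suc (toℕ l))) (term y u) n)
      ≡⟨ cong (c *_) (conv-ΣLʳ (bounded L b) (δ (suc (toℕ l))) (term y) n) ⟨
        c * conv (δ (suc (toℕ l))) (expansion y) n
      ≡⟨ conv-*ˡ c (δ (suc (toℕ l))) (expansion y) n ⟨
        conv (monomial l) (expansion y) n
      ∎
      where
      open ≡-Reasoning
      c : ℤ
      c = binom x (suc (toℕ l))
      shifted : Vec ℕ L → ℤ
      shifted u = δ (suc (toℕ l) ℕ.+ weight u) n * (+ multinomial y u * powerProduct x u)
      factor-out : ∀ v → δ (weight v) n * powerProduct x v * (positive (lookup v l) * + multinomial y (decAt v l)) ≡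
                         c * (positive (lookup v l) * shifted (decAt v l))
      factor-out v with lookup v l in e
      ... | zero  = regroup (δ (weight v) n * powerProduct x v) (+ multinomial y (decAt v l)) c (shifted (decAt v l))
        where
        regroup : ∀ a m c h → a * (+ 0 * m) ≡ c * (+ 0 * h)
        regroup = solve-∀
      ... | suc k = trans (cong₂ (λ w q → δ w n * q * (+ 1 * + multinomial y (decAt v l)))
                      (weightedSum-decAt (λ j → suc (toℕ j)) v l k e)
                          (powerProduct-decAt (λ j → binom x (suc (toℕ j))) v l k e))
                      (regroup (δ (suc (toℕ l) ℕ.+ weight (decAt v l)) n) c (powerProduct x (decAt v l))
                          (+ multinomial y (decAt v l)))
        where
        regroup : ∀ d a c m → d * (a * c) * (+ 1 * m) ≡ a * (+ 1 * (d * (m * c)))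
        regroup = solve-∀
      shifted-over : ∀ u → b ≤ Vec.sum u → shifted u ≡ + 0
      shifted-over u b≤sum = trans (cong (λ z → δ (suc (toℕ l) ℕ.+ weight u) n * (+ z * powerProduct x u))
          (multinomial-over y u (ℕₚ.<-≤-trans 1+y≤b b≤sum)))
        (trans (cong (δ (suc (toℕ l) ℕ.+ weight u) n *_) (ℤₚ.*-zeroˡ (powerProduct x u)))
            (ℤₚ.*-zeroʳ (δ (suc (toℕ l) ℕ.+ weight u) n)))
      shifted≡conv : ∀ u → shifted u ≡ conv (δ (suc (toℕ l))) (term y u) n
      shifted≡conv u = sym (conv-δ-δ*ʳ (suc (toℕ l)) (weight u) (+ multinomial y u * powerProduct x u) n)

    expansion-suc : ∀ y → suc y ≤ b → ∀ n → expansion (suc y) n ≡ conv (binom x) (expansion y) n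
    expansion-suc y 1+y≤b n = begin
        expansion (suc y) n
      ≡⟨ ΣL-cong (bounded L b) pascal ⟩
        ΣL (bounded L b) (λ v → term y v n + ΣFin L (λ l → raised v l))
      ≡⟨ ΣL-+ (bounded L b) (λ v → term y v n) (λ v → ΣFin L (raised v)) ⟩
        expansion y n + ΣL (bounded L b) (λ v → ΣFin L (raised v))
      ≡⟨ cong (_+_ (expansion y n)) (ΣL-ΣFin (bounded L b) L raised) ⟩
        expansion y n + ΣFin L (λ l → ΣL (bounded L b) (λ v → raised v l))
      ≡⟨ cong₂ _+_ (conv-δ 0 (expansion y) n z≤n) (ΣFin-cong L (λ l → sym (conv-monomial y 1+y≤b l n))) ⟨
        conv (δ 0) (expansion y) n + ΣFin L (λ l → conv (monomial l) (expansion y) n)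
      ≡⟨ cong (_+_ (conv (δ 0) (expansion y) n)) (conv-ΣFinˡ L monomial (expansion y) n) ⟨
        conv (δ 0) (expansion y) n + conv (λ j → ΣFin L (λ l → monomial l j)) (expansion y) n
      ≡⟨ conv-+ˡ (δ 0) (λ j → ΣFin L (λ l → monomial l j)) (expansion y) n ⟨
        conv (λ j → δ 0 j + ΣFin L (λ l → monomial l j)) (expansion y) n
      ≡⟨ conv-cong n (λ j _ → binom≡1+Σmonomial j) (λ _ _ → refl) ⟨
        conv (binom x) (expansion y) n
      ∎
      where
      open ≡-Reasoning
      raised : Vec ℕ L → Fin L → ℤ
      raised v l = δ (weight v) n * powerProduct x v * (positive (lookup v l) * + multinomial y (decAt v l))
      distribute : ∀ d m s c → d * ((m + s) * c) ≡ d * (m * c) + (d * c) * s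
      distribute = solve-∀
      pascal : ∀ v → term (suc y) v n ≡ term y v n + ΣFin L (raised v)
      pascal v = trans (cong (λ z → δ (weight v) n * (z * powerProduct x v)) (multinomial-pascal y v))
        (trans (distribute (δ (weight v) n) (+ multinomial y v) _ (powerProduct x v))
          (cong (_+_ (term y v n)) (sym (ΣFin-*ˡ L (δ (weight v) n * powerProduct x v) _))))

    multinomial-theorem : ∀ y → y ≤ b → ∀ n → expansion y n ≡ binom (x ℕ.* y) n
    multinomial-theorem zero    _     n = trans (expansion-0 n)
        (sym (trans (cong (λ z → binom z n) (ℕₚ.*-zeroʳ x)) (binom-0 n)))
    multinomial-theorem (suc y) 1+y≤b n = begin
        expansion (suc y) n
      ≡⟨ expansion-suc y 1+y≤b n ⟩
        conv (binom x) (expansion y) n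
      ≡⟨ conv-cong n (λ _ _ → refl) (λ m _ → multinomial-theorem y (ℕₚ.≤-trans (ℕₚ.n≤1+n y) 1+y≤b) m) ⟩
        conv (binom x) (binom (x ℕ.* y)) n
      ≡⟨ vandermonde x (x ℕ.* y) n ⟨
        binom (x ℕ.+ x ℕ.* y) n
      ≡⟨ cong (λ z → binom z n) (ℕₚ.*-suc x y) ⟨
        binom (x ℕ.* suc y) n
      ∎
      where open ≡-Reasoning

  falling : ℕ → ℕ → ℕ
  falling Y zero    = 1
  falling Y (suc s) = Y ℕ.* falling (Y ∸ 1) s

  fall≡falling : ∀ Y s → fall (+ Y) s ≡ + falling Y s
  fall≡falling Y       zero    = refl
  fall≡falling zero    (suc s) = ℤₚ.*-zeroˡ (ΠFin s (λ i → + 0 ℤ.- + toℕ (Fin.suc i)))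
  fall≡falling (suc Y) (suc s) = trans (cong₂ _*_ (cong +_ (ℕₚ.+-identityʳ (suc Y)))
    (trans (ΠFin-cong s (λ i → trans (ℤₚ.m-n≡m⊖n (suc Y) (suc (toℕ i)))
      (trans (ℤₚ.[1+m]⊖[1+n]≡m⊖n Y (toℕ i)) (sym (ℤₚ.m-n≡m⊖n Y (toℕ i))))))
      (fall≡falling Y s))) (sym (ℤₚ.pos-* (suc Y) _))

  falling≡choose*! : ∀ Y s → falling Y s ≡ choose Y s ℕ.* s !
  falling≡choose*! Y       zero    = refl
  falling≡choose*! zero    (suc s) = refl
  falling≡choose*! (suc Y) (suc s) = begin
      suc Y ℕ.* falling Y s
    ≡⟨ cong (suc Y ℕ.*_) (falling≡choose*! Y s) ⟩
      suc Y ℕ.* (choose Y s ℕ.* s !)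
    ≡⟨ ℕₚ.*-assoc (suc Y) (choose Y s) (s !) ⟨
      suc Y ℕ.* choose Y s ℕ.* s !
    ≡⟨ cong (ℕ._* s !) (choose-absorb Y s) ⟨
      suc s ℕ.* choose (suc Y) (suc s) ℕ.* s !
    ≡⟨ regroup (suc s) (choose (suc Y) (suc s)) (s !) ⟩
      choose (suc Y) (suc s) ℕ.* (suc s ℕ.* s !)
    ∎
    where
    open ≡-Reasoning
    regroup : ∀ a b c → a ℕ.* b ℕ.* c ≡ b ℕ.* (a ℕ.* c)
    regroup = ℕ-Solver.solve-∀

  falling-+ : ∀ Y a b → falling Y (a ℕ.+ b) ≡ falling Y a ℕ.* falling (Y ∸ a) b
  falling-+ Y zero    b = sym (ℕₚ.+-identityʳ _)
  falling-+ Y (suc a) b = trans (cong (Y ℕ.*_) (falling-+ (Y ∸ 1) a b))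
    (trans (sym (ℕₚ.*-assoc Y _ _)) (cong (λ z → Y ℕ.* falling (Y ∸ 1) a ℕ.* falling z b) (ℕₚ.∸-+-assoc Y 1 a)))

  factorials : ∀ {L} → Vec ℕ L → ℕ
  factorials []      = 1
  factorials (c ∷ v) = c ! ℕ.* factorials v

  ΠFin-factℤ : ∀ {L} (v : Vec ℕ L) → ΠFin L (λ j → factℤ (lookup v j)) ≡ + factorials v
  ΠFin-factℤ []      = refl
  ΠFin-factℤ (c ∷ v) = trans (cong (factℤ c *_) (ΠFin-factℤ v)) (sym (ℤₚ.pos-* (c !) _))

  multinomial*factorials : ∀ {L} Y (v : Vec ℕ L) → multinomial Y v ℕ.* factorials v ≡ falling Y (Vec.sum v)
  multinomial*factorials Y []      = refl
  multinomial*factorials Y (c ∷ v) = begin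
      choose Y c ℕ.* multinomial (Y ∸ c) v ℕ.* (c ! ℕ.* factorials v)
    ≡⟨ regroup (choose Y c) (multinomial (Y ∸ c) v) (c !) (factorials v) ⟩
      choose Y c ℕ.* c ! ℕ.* (multinomial (Y ∸ c) v ℕ.* factorials v)
    ≡⟨ cong₂ ℕ._*_ (sym (falling≡choose*! Y c)) (multinomial*factorials (Y ∸ c) v) ⟩
      falling Y c ℕ.* falling (Y ∸ c) (Vec.sum v)
    ≡⟨ falling-+ Y c (Vec.sum v) ⟨
      falling Y (c ℕ.+ Vec.sum v)
    ∎
    where
    open ≡-Reasoning
    regroup : ∀ a b c d → a ℕ.* b ℕ.* (c ℕ.* d) ≡ a ℕ.* c ℕ.* (b ℕ.* d)
    regroup = ℕ-Solver.solve-∀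

module DigitProduct (p : ℕ) (p-prime : Prime p) (ks : List (Vec ℕ (p ∸ 1)))
    (ks-enumerates : ∀ k → (k ∈ ks) ⇔ ((Vec.sum k ≤ p ∸ 1) × (k ≢ Vec.replicate (p ∸ 1) 0)))
    (ks-unique : Unique ks) where
  open import Data.Integer using (_+_; _*_; _^_)
  open Series
  open Congruence p p-prime
  open BinomialModP p p-prime
  open Multinomial p ks

  L : ℕ
  L = p ∸ 1

  ≤L⇒<p : ∀ {n} → n ≤ L → n < p
  ≤L⇒<p n≤L = subst (_ <_) suc[p∸1]≡p (s≤s n≤L)

  <p⇒≤L : ∀ {n} → n < p → n ≤ L
  <p⇒≤L n<p = ℕₚ.≤-pred (subst (_ <_) (sym suc[p∸1]≡p) n<p)

  p∤factorials : ∀ {L} (v : Vec ℕ L) → Vec.sum v < p → ¬ (p ℕ∣.∣ factorials v)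
  p∤factorials []      _       = p∤! 0 0<p
  p∤factorials (c ∷ v) sum<p = p∤-* (c !) (factorials v) (p∤! c (ℕₚ.≤-<-trans (ℕₚ.m≤m+n c _) sum<p))
    (p∤factorials v (ℕₚ.≤-<-trans (ℕₚ.m≤n+m _ c) sum<p))

  fall/!≈binom : ∀ X (j : Fin L) → fall (+ X) (suc (toℕ j)) * invₚ p (factℤ (suc (toℕ j))) ≈ binom X (suc (toℕ j)) * + 1
  fall/!≈binom X j = ≈-trans (≡⇒≈ (trans (cong (_* invₚ p (factℤ (suc (toℕ j))))
      (trans (fall≡falling X (suc (toℕ j)))
          (trans (cong +_ (falling≡choose*! X (suc (toℕ j)))) (ℤₚ.pos-* (choose X (suc (toℕ j))) _))))
      (ℤₚ.*-assoc (binom X (suc (toℕ j))) _ _)))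
    (≈-* (≈-refl {binom X (suc (toℕ j))}) (fermat-inverse (suc (toℕ j) !) (p∤! (suc (toℕ j)) (≤L⇒<p (Finₚ.toℕ<n j)))))

  π≈multinomial : ∀ (k : Vec ℕ L) X Y → Vec.sum k ≤ L → πₚ p k (+ X) (+ Y) ≈ + multinomial Y k * powerProduct X k
  π≈multinomial k X Y sum≤L = begin
      fall (+ Y) (Vec.sum k) * invₚ p (ΠFin L (λ j → factℤ (lookup k j))) * binomials
    ≡⟨ cong₂ (λ a b → a * invₚ p b * binomials)
         (trans (fall≡falling Y (Vec.sum k))
             (trans (cong +_ (sym (multinomial*factorials Y k))) (ℤₚ.pos-* (multinomial Y k) (factorials k))))
         (ΠFin-factℤ k) ⟩
      + multinomial Y k * + factorials k * invₚ p (+ factorials k) * binomials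
    ≈⟨ ≈-* (≈-trans (≡⇒≈ (ℤₚ.*-assoc (+ multinomial Y k) _ _))
              (≈-* (≈-refl {+ multinomial Y k}) (fermat-inverse (factorials k) (p∤factorials k (≤L⇒<p sum≤L)))))
            (ΠFin-≈ L (λ j → ≈-^ (lookup k j) (fall/!≈binom X j))) ⟩
      + multinomial Y k * + 1 * ΠFin L (λ j → (binom X (suc (toℕ j)) * + 1) ^ lookup k j)
    ≡⟨ cong₂ _*_ (ℤₚ.*-identityʳ (+ multinomial Y k))
         (ΠFin-cong L (λ j → cong (_^ lookup k j) (ℤₚ.*-identityʳ (binom X (suc (toℕ j)))))) ⟩
      + multinomial Y k * powerProduct X k
    ∎
    where
    open ≈-Reasoning
    binomials : ℤ
    binomials = ΠFin L (λ j → (fall (+ X) (suc (toℕ j)) * invₚ p (factℤ (suc (toℕ j)))) ^ lookup k j)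

  count : List (Vec ℕ L) → Vec ℕ L → ℤ
  count xs v = ΣL xs (λ k → if eqV k v then + 1 else + 0)

  count-∉ : ∀ xs v → ¬ (v ∈ xs) → count xs v ≡ + 0
  count-∉ []       v _   = refl
  count-∉ (x ∷ xs) v v∉ = cong₂ _+_
      (cong (λ β → if β then + 1 else + 0) (≢⇒eqV-false x v (λ x≡v → v∉ (here (sym x≡v)))))
    (count-∉ xs v (v∉ ∘ there))

  count-∈ : ∀ xs v → Unique xs → v ∈ xs → count xs v ≡ + 1
  count-∈ (x ∷ xs) v (x∉xs ∷ _) (here refl) = cong₂ _+_ (cong (λ β → if β then + 1 else + 0) (eqV-refl x))
    (count-∉ xs x (λ x∈xs → All.lookup x∉xs x∈xs refl))
  count-∈ (x ∷ xs) v (x≢xs ∷ u) (there v∈xs) = trans (cong₂ _+_ (cong (λ β → if β then + 1 else + 0)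
    (≢⇒eqV-false x v (All.lookup x≢xs v∈xs))) (count-∈ xs v u v∈xs)) (ℤₚ.+-identityˡ _)

  ΣL-ks : ∀ F → ΣL ks F ≡ ΣL (bounded L L) (λ v → if eqV (zeros L) v then + 0 else F v)
  ΣL-ks F = begin
      ΣL ks F
    ≡⟨ ΣL-cong∈ ks (λ k k∈ → sym (ΣL-bounded-eqV L L k F (proj₁ (Equivalence.to (ks-enumerates k) k∈)))) ⟩
      ΣL ks (λ k → ΣL (bounded L L) (λ v → if eqV k v then F v else + 0))
    ≡⟨ ΣL-comm ks (bounded L L) (λ k v → if eqV k v then F v else + 0) ⟩
      ΣL (bounded L L) (λ v → ΣL ks (λ k → if eqV k v then F v else + 0))
    ≡⟨ ΣL-bounded-cong L L multiplicity ⟩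
      ΣL (bounded L L) (λ v → if eqV (zeros L) v then + 0 else F v)
    ∎
    where
    open ≡-Reasoning
    multiplicity : ∀ v → Vec.sum v ≤ L → ΣL ks (λ k → if eqV k v then F v else + 0) ≡
        (if eqV (zeros L) v then + 0 else F v)
    multiplicity v sum≤L = trans (ΣL-cong ks (λ k → scale (eqV k v)))
      (trans (ΣL-*ˡ ks (F v) (λ k → if eqV k v then + 1 else + 0)) (by-zeros (eqV (zeros L) v) refl))
      where
      scale : ∀ β → (if β then F v else + 0) ≡ F v * (if β then + 1 else + 0)
      scale true  = sym (ℤₚ.*-identityʳ (F v))
      scale false = sym (ℤₚ.*-zeroʳ (F v))
      by-zeros : ∀ β → eqV (zeros L) v ≡ β → F v * count ks v ≡ (if β then + 0 else F v)
      by-zeros true  e = trans (cong (F v *_)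
          (count-∉ ks v (λ v∈ → proj₂ (Equivalence.to (ks-enumerates v) v∈) (sym (eqV⇒≡ _ _ e)))))
        (ℤₚ.*-zeroʳ (F v))
      by-zeros false e = trans (cong (F v *_) (count-∈ ks v ks-unique
        (Equivalence.from (ks-enumerates v) (sum≤L , (λ v≡0 → eqV-false⇒≢ _ _ e (sym v≡0)))))) (ℤₚ.*-identityʳ (F v))

  ΣL-bounded-≈ : ∀ n b {f g : Vec ℕ n → ℤ} → (∀ v → Vec.sum v ≤ b → f v ≈ g v) → ΣL (bounded n b) f ≈ ΣL (bounded n b) g
  ΣL-bounded-≈ = BoundedSumCong.ΣL-bounded-congᴿ _≈_ ≈-+ ≈-refl

  digit-product : ∀ X Y → X < p → Y < p → ∀ n →
    δ 0 n + ΣL ks (λ k → πₚ p k (+ X) (+ Y) * δ (wt p k) n) ≈ binom (X ℕ.* Y) n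
  digit-product X Y X<p Y<p n = begin
      δ 0 n + ΣL ks (λ k → πₚ p k (+ X) (+ Y) * δ (wt p k) n)
    ≡⟨ cong₂ _+_ (sym zeros-term) (ΣL-ks (λ k → πₚ p k (+ X) (+ Y) * δ (wt p k) n)) ⟩
      ΣL (bounded L L) (λ v → if zero? v then term Y v n else + 0)
        + ΣL (bounded L L) (λ v → if zero? v then + 0 else πₚ p v (+ X) (+ Y) * δ (wt p v) n)
    ≈⟨ ≈-+ (≈-refl {ΣL (bounded L L) (λ v → if zero? v then term Y v n else + 0)})
          (ΣL-bounded-≈ L L (λ v sum≤L → unless-≈ (zero? v) (π≈term v sum≤L))) ⟩
      ΣL (bounded L L) (λ v → if zero? v then term Y v n else + 0) + ΣL (bounded L L)
          (λ v → if zero? v then + 0 else term Y v n)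
    ≡⟨ ΣL-+ (bounded L L) (λ v → if zero? v then term Y v n else + 0) (λ v → if zero? v then + 0 else term Y v n) ⟨
      ΣL (bounded L L) (λ v → (if zero? v then term Y v n else + 0) + (if zero? v then + 0 else term Y v n))
    ≡⟨ ΣL-cong (bounded L L) (λ v → if-split (zero? v) (term Y v n)) ⟩
      expansion Y n
    ≡⟨ multinomial-theorem Y (<p⇒≤L Y<p) n ⟩
      binom (X ℕ.* Y) n
    ∎
    where
    open ≈-Reasoning
    open MultinomialTheorem L L X (<p⇒≤L X<p)
    zero? : Vec ℕ L → Bool
    zero? = eqV (zeros L)
    zeros-term : ΣL (bounded L L) (λ v → if zero? v then term Y v n else + 0) ≡ δ 0 n
    zeros-term = trans (ΣL-bounded-eqV L L (zeros L) (λ v → term Y v n) (subst (_≤ L) (sym (sum-zeros L)) z≤n))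
      (trans (cong₂ (λ w c → δ w n * (+ multinomial Y (zeros L) * c)) (weightedSum-zeros L (λ j → suc (toℕ j)))
        (powerProduct-zeros L (λ j → binom X (suc (toℕ j)))))
        (trans (cong (λ m → δ 0 n * (+ m * + 1)) (multinomial-zeros L Y)) (ℤₚ.*-identityʳ (δ 0 n))))
    if-split : ∀ β (a : ℤ) → (if β then a else + 0) + (if β then + 0 else a) ≡ a
    if-split true  a = ℤₚ.+-identityʳ a
    if-split false a = ℤₚ.+-identityˡ a
    unless-≈ : ∀ β {a b : ℤ} → a ≈ b → (if β then + 0 else a) ≈ (if β then + 0 else b)
    unless-≈ true  _   = ≈-refl
    unless-≈ false a≈b = a≈b
    π≈term : ∀ v → Vec.sum v ≤ L → πₚ p v (+ X) (+ Y) * δ (wt p v) n ≈ term Y v n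
    π≈term v sum≤L = ≈-trans (≈-* (π≈multinomial v X Y sum≤L) (≈-refl {δ (wt p v) n}))
      (≡⇒≈ (ℤₚ.*-comm (+ multinomial Y v * powerProduct X v) (δ (wt p v) n)))

module DisjointTuples (P₀ : ℕ) (KS : List (Vec ℕ (P₀ ∸ 1))) where
  open import Data.Integer using (_+_; _*_)
  open Series
  open Multinomial P₀ KS using (eqV)

  subsets : (n : ℕ) → List (Subset n)
  subsets = allSubsets P₀ KS

  tuples : (j n : ℕ) → List (Vec (Subset n) j)
  tuples = allTuples P₀ KS

  disjoint? : ∀ {n j} → Vec (Subset n) j → Bool
  disjoint? = pairwiseDisjointᵇ P₀ KS

  ΣL-subsets-suc : ∀ n (f : Subset (suc n) → ℤ) → ΣL (subsets (suc n)) f ≡ ΣL (subsets n)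
      (λ s → f (false ∷ s) + f (true ∷ s))
  ΣL-subsets-suc n f = trans (ΣL-concatMap (λ s → (false ∷ s) ∷ (true ∷ s) ∷ []) (subsets n) f)
    (ΣL-cong (subsets n) (λ s → cong (_+_ (f (false ∷ s))) (ℤₚ.+-identityʳ (f (true ∷ s)))))

  ΣL-tuples-suc : ∀ j n (f : Vec (Subset n) (suc j) → ℤ) → ΣL (tuples (suc j) n) f ≡ ΣL (tuples j n)
      (λ S → ΣL (subsets n) (λ s → f (s ∷ S)))
  ΣL-tuples-suc j n f = trans (ΣL-concatMap (λ S → map (Vec._∷ S) (subsets n)) (tuples j n) f)
    (ΣL-cong (tuples j n) (λ S → ΣL-map (Vec._∷ S) (subsets n) f))

  ΣL-tuples-0 : ∀ K (f : Vec (Subset 0) K → ℤ) → ΣL (tuples K 0) f ≡ f (Vec.replicate K [])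
  ΣL-tuples-0 zero f = ℤₚ.+-identityʳ (f [])
  ΣL-tuples-0 (suc K) f = trans (ΣL-tuples-suc K 0 f)
      (trans (ΣL-tuples-0 K (λ S → ΣL (subsets 0) (λ s → f (s ∷ S)))) (ℤₚ.+-identityʳ _))

  -- A K-tuple of subsets of {0,…,n} is a K × (n+1) Boolean matrix; addColumn prepends its column 0.
  addColumn : ∀ {K n} → Vec Bool K → Vec (Subset n) K → Vec (Subset (suc n)) K
  addColumn [] [] = []
  addColumn (b ∷ bs) (s ∷ ss) = (b ∷ s) ∷ addColumn bs ss

  ΣL-tuples-addColumn : ∀ K P (h : Vec (Subset (suc P)) K → ℤ) →
    ΣL (tuples K (suc P)) h ≡ ΣL (tuples K P) (λ S → ΣL (subsets K) (λ col → h (addColumn col S)))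
  ΣL-tuples-addColumn zero P h = trans (ℤₚ.+-identityʳ (h [])) (sym (trans (ℤₚ.+-identityʳ _) (ℤₚ.+-identityʳ _)))
  ΣL-tuples-addColumn (suc K) P h = begin
      ΣL (tuples (suc K) (suc P)) h
    ≡⟨ ΣL-tuples-suc K (suc P) h ⟩
      ΣL (tuples K (suc P)) (λ S′ → ΣL (subsets (suc P)) (λ s′ → h (s′ ∷ S′)))
    ≡⟨ ΣL-cong (tuples K (suc P)) (λ S′ → ΣL-subsets-suc P (λ s′ → h (s′ ∷ S′))) ⟩
      ΣL (tuples K (suc P)) (λ S′ → ΣL (subsets P) (λ s → both s S′))
    ≡⟨ ΣL-tuples-addColumn K P (λ S′ → ΣL (subsets P) (λ s → both s S′)) ⟩
      ΣL (tuples K P) (λ S → ΣL (subsets K) (λ col → ΣL (subsets P) (λ s → both s (addColumn col S))))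
    ≡⟨ ΣL-cong (tuples K P) (λ S → ΣL-comm (subsets K) (subsets P) (λ col s → both s (addColumn col S))) ⟩
      ΣL (tuples K P) (λ S → ΣL (subsets P) (λ s → ΣL (subsets K) (λ col → both s (addColumn col S))))
    ≡⟨ ΣL-cong (tuples K P) (λ S → ΣL-cong (subsets P) (λ s → ΣL-subsets-suc K (λ col → h (addColumn col (s ∷ S))))) ⟨
      ΣL (tuples K P) (λ S → ΣL (subsets P) (λ s → ΣL (subsets (suc K)) (λ col → h (addColumn col (s ∷ S)))))
    ≡⟨ ΣL-tuples-suc K P (λ S → ΣL (subsets (suc K)) (λ col → h (addColumn col S))) ⟨
      ΣL (tuples (suc K) P) (λ S → ΣL (subsets (suc K)) (λ col → h (addColumn col S)))
    ∎
    where
    open ≡-Reasoning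
    both : Subset P → Vec (Subset (suc P)) K → ℤ
    both s S′ = h ((false ∷ s) ∷ S′) + h ((true ∷ s) ∷ S′)

  atMostOne : ∀ {K} → Vec Bool K → Bool
  atMostOne [] = true
  atMostOne (b ∷ bs) = allᵇ P₀ KS (λ c → not (b ∧ c)) bs ∧ atMostOne bs

  allᵇ-addColumn : ∀ {K n} b (s : Subset n) (bs : Vec Bool K) (ss : Vec (Subset n) K) →
    allᵇ P₀ KS (disjointᵇ P₀ KS (b ∷ s)) (addColumn bs ss) ≡ allᵇ P₀ KS (λ c → not (b ∧ c)) bs ∧ allᵇ P₀ KS
        (disjointᵇ P₀ KS s) ss
  allᵇ-addColumn b s [] [] = refl
  allᵇ-addColumn b s (c ∷ bs) (t ∷ ss) = trans
      (cong (_∧_ (not (b ∧ c) ∧ disjointᵇ P₀ KS s t)) (allᵇ-addColumn b s bs ss))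
    (∧-interchange (not (b ∧ c)) (disjointᵇ P₀ KS s t) _ _)

  disjoint?-addColumn : ∀ {K n} (col : Vec Bool K) (S : Vec (Subset n) K) → disjoint?
      (addColumn col S) ≡ atMostOne col ∧ disjoint? S
  disjoint?-addColumn [] [] = refl
  disjoint?-addColumn (b ∷ bs) (s ∷ ss) = trans (cong₂ _∧_ (allᵇ-addColumn b s bs ss) (disjoint?-addColumn bs ss))
      (∧-interchange (allᵇ P₀ KS (λ c → not (b ∧ c)) bs) (allᵇ P₀ KS (disjointᵇ P₀ KS s) ss) (atMostOne bs)
      (disjoint? ss))

  lookup-addColumn : ∀ {K n} (col : Vec Bool K) (S : Vec (Subset n) K) j → lookup
      (addColumn col S) j ≡ lookup col j ∷ lookup S j
  lookup-addColumn (b ∷ bs) (s ∷ ss) Fin.zero = refl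
  lookup-addColumn (b ∷ bs) (s ∷ ss) (Fin.suc j) = lookup-addColumn bs ss j

  product : ∀ {K P} → (Fin K → ℕ → ℤ) → Vec (Subset P) K → ℤ
  product {K} {P} g S = ΠFin K (λ j → ΠFin P (λ i → if lookup (lookup S j) i then g j (toℕ i) else + 1))

  columnProduct : ∀ {K} → (Fin K → ℕ → ℤ) → Vec Bool K → ℤ
  columnProduct {K} g col = ΠFin K (λ j → if lookup col j then g j 0 else + 1)

  product-addColumn : ∀ {K P} (g : Fin K → ℕ → ℤ) col (S : Vec (Subset P) K) →
    product g (addColumn col S) ≡ columnProduct g col * product (λ j i → g j (suc i)) S
  product-addColumn {K} {P} g col S = trans (ΠFin-cong K (λ j →
      cong (λ s → ΠFin (suc P) (λ i → if lookup s i then g j (toℕ i) else + 1)) (lookup-addColumn col S j)))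
    (ΠFin-* K _ _)

  bit : Bool → ℕ
  bit true = 1
  bit false = 0

  ∣∷∣ : ∀ {n} b (s : Subset n) → ∣ b ∷ s ∣ ≡ bit b ℕ.+ ∣ s ∣
  ∣∷∣ true s = refl
  ∣∷∣ false s = refl

  cards : ∀ {K n} → Vec (Subset n) K → Vec ℕ K
  cards S = Vec.map ∣_∣ S

  bits : ∀ {K} → Vec Bool K → Vec ℕ K
  bits col = Vec.map bit col

  cardsᵇ≡eqV : ∀ {K n} (S : Vec (Subset n) K) l → cardsᵇ P₀ KS S l ≡ eqV (cards S) l
  cardsᵇ≡eqV [] [] = refl
  cardsᵇ≡eqV (s ∷ ss) (l ∷ ls) = cong ((∣ s ∣ ≡ᵇ l) ∧_) (cardsᵇ≡eqV ss ls)

  weightDot : ∀ {K} → (Fin K → ℕ) → Vec ℕ K → ℕ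
  weightDot {K} w l = ΣFinℕ K (λ j → w j ℕ.* lookup l j)

  weightDot-addColumn : ∀ {K n} (w : Fin K → ℕ) col (S : Vec (Subset n) K) → weightDot w
      (cards (addColumn col S)) ≡ weightDot w (bits col) ℕ.+ weightDot w (cards S)
  weightDot-addColumn w [] [] = refl
  weightDot-addColumn w (b ∷ bs) (s ∷ ss) = trans
      (cong₂ (λ a c → w Fin.zero ℕ.* a ℕ.+ c) (∣∷∣ b s) (weightDot-addColumn (w ∘ Fin.suc) bs ss))
    (regroup (w Fin.zero) (bit b) ∣ s ∣ _ _)
    where
    regroup : ∀ w a c x y → w ℕ.* (a ℕ.+ c) ℕ.+ (x ℕ.+ y) ≡ w ℕ.* a ℕ.+ x ℕ.+ (w ℕ.* c ℕ.+ y)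
    regroup = ℕ-Solver.solve-∀

  sum-addColumn : ∀ {K n} col (S : Vec (Subset n) K) → Vec.sum (cards (addColumn col S)) ≡ Vec.sum
      (bits col) ℕ.+ Vec.sum (cards S)
  sum-addColumn [] [] = refl
  sum-addColumn (b ∷ bs) (s ∷ ss) = trans (cong₂ ℕ._+_ (∣∷∣ b s) (sum-addColumn bs ss)) (regroup (bit b) ∣ s ∣ _ _)
    where
    regroup : ∀ a c x y → a ℕ.+ c ℕ.+ (x ℕ.+ y) ≡ a ℕ.+ x ℕ.+ (c ℕ.+ y)
    regroup = ℕ-Solver.solve-∀

  all-false⇒sum≡0 : ∀ {K} (bs : Vec Bool K) → allᵇ P₀ KS not bs ≡ true → Vec.sum (bits bs) ≡ 0
  all-false⇒sum≡0 [] _ = refl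
  all-false⇒sum≡0 (false ∷ bs) e = all-false⇒sum≡0 bs e

  atMostOne⇒sum≤1 : ∀ {K} (col : Vec Bool K) → atMostOne col ≡ true → Vec.sum (bits col) ≤ 1
  atMostOne⇒sum≤1 [] _ = z≤n
  atMostOne⇒sum≤1 (true ∷ bs) e = ℕₚ.≤-reflexive (cong suc (all-false⇒sum≡0 bs (Boolₚ.∧-conicalˡ _ _ e)))
  atMostOne⇒sum≤1 (false ∷ bs) e = atMostOne⇒sum≤1 bs (Boolₚ.∧-conicalʳ _ _ e)

  split-column : ∀ {K n} (S : Vec (Subset (suc n)) K) → Σ (Vec Bool K)
      (λ col → Σ (Vec (Subset n) K) (λ S′ → S ≡ addColumn col S′))
  split-column [] = [] , [] , refl
  split-column ((b ∷ s) ∷ ss) with split-column ss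
  ... | col , S′ , e = b ∷ col , s ∷ S′ , cong ((b ∷ s) ∷_) e

  sum-cards-empty : ∀ {K} (S : Vec (Subset 0) K) → Vec.sum (cards S) ≡ 0
  sum-cards-empty [] = refl
  sum-cards-empty ([] ∷ ss) = sum-cards-empty ss

  disjoint⇒sum≤ : ∀ {K} P (S : Vec (Subset P) K) → disjoint? S ≡ true → Vec.sum (cards S) ≤ P
  disjoint⇒sum≤ zero S _ = ℕₚ.≤-reflexive (sum-cards-empty S)
  disjoint⇒sum≤ (suc P) S e with split-column S
  ... | col , S′ , refl = subst (_≤ suc P) (sym (sum-addColumn col S′))
    (ℕₚ.+-mono-≤ (atMostOne⇒sum≤1 col (Boolₚ.∧-conicalˡ _ _ both)) (disjoint⇒sum≤ P S′ (Boolₚ.∧-conicalʳ _ _ both)))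
    where
    both : atMostOne col ∧ disjoint? S′ ≡ true
    both = trans (sym (disjoint?-addColumn col S′)) e

  noColumn : ∀ K → Vec Bool K
  noColumn K = Vec.replicate K false

  unitColumn : ∀ {K} → Fin K → Vec Bool K
  unitColumn {suc K} Fin.zero = true ∷ noColumn K
  unitColumn (Fin.suc j) = false ∷ unitColumn j

  allᵇ-true : ∀ {K} (c : Vec Bool K) → allᵇ P₀ KS (λ _ → true) c ≡ true
  allᵇ-true [] = refl
  allᵇ-true (b ∷ c) = allᵇ-true c

  ΣL-all-false : ∀ K (B : Vec Bool K → Bool) (g : Vec Bool K → ℤ) →
    ΣL (subsets K) (λ c → if allᵇ P₀ KS not c ∧ B c then g c else + 0) ≡
        (if B (noColumn K) then g (noColumn K) else + 0)
  ΣL-all-false zero B g = ℤₚ.+-identityʳ _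
  ΣL-all-false (suc K) B g = trans (ΣL-subsets-suc K _)
      (trans (ΣL-cong (subsets K) (λ c → ℤₚ.+-identityʳ _))
      (ΣL-all-false K (λ c → B (false ∷ c)) (λ c → g (false ∷ c))))

  atMostOne-noColumn : ∀ K → atMostOne (noColumn K) ≡ true
  atMostOne-noColumn zero = refl
  atMostOne-noColumn (suc K) = trans (cong (_∧ atMostOne (noColumn K)) (allᵇ-true (noColumn K))) (atMostOne-noColumn K)

  ΣL-atMostOne : ∀ K (h : Vec Bool K → ℤ) →
    ΣL (subsets K) (λ col → if atMostOne col then h col else + 0) ≡ h (noColumn K) + ΣFin K (λ j → h (unitColumn j))
  ΣL-atMostOne zero h = refl
  ΣL-atMostOne (suc K) h = begin
      ΣL (subsets (suc K)) (λ col → if atMostOne col then h col else + 0)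
    ≡⟨ ΣL-subsets-suc K _ ⟩
      ΣL (subsets K) (λ c → F (false ∷ c) + F (true ∷ c))
    ≡⟨ ΣL-+ (subsets K) (λ c → F (false ∷ c)) (λ c → F (true ∷ c)) ⟩
      ΣL (subsets K) (λ c → F (false ∷ c)) + ΣL (subsets K) (λ c → F (true ∷ c))
    ≡⟨ cong₂ _+_
         (trans (ΣL-cong (subsets K) (λ c → cong (λ β → if β ∧ atMostOne c then h (false ∷ c) else + 0) (allᵇ-true c)))
           (ΣL-atMostOne K (λ c → h (false ∷ c))))
         (trans (ΣL-all-false K atMostOne (λ c → h (true ∷ c)))
           (cong (λ β → if β then h (true ∷ noColumn K) else + 0) (atMostOne-noColumn K))) ⟩
      h (false ∷ noColumn K) + ΣFin K (λ j → h (false ∷ unitColumn j)) + h (true ∷ noColumn K)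
    ≡⟨ regroup (h (false ∷ noColumn K)) (ΣFin K (λ j → h (false ∷ unitColumn j))) (h (true ∷ noColumn K)) ⟩
      h (false ∷ noColumn K) + (h (true ∷ noColumn K) + ΣFin K (λ j → h (false ∷ unitColumn j)))
    ∎
    where
    open ≡-Reasoning
    F : Vec Bool (suc K) → ℤ
    F col = if atMostOne col then h col else + 0
    regroup : ∀ a b c → a + b + c ≡ a + (c + b)
    regroup = solve-∀

  columnProduct-noColumn : ∀ {K} (g : Fin K → ℕ → ℤ) → columnProduct g (noColumn K) ≡ + 1
  columnProduct-noColumn {zero} g = refl
  columnProduct-noColumn {suc K} g = trans (ℤₚ.*-identityˡ _) (columnProduct-noColumn (g ∘ Fin.suc))

  columnProduct-unitColumn : ∀ {K} (g : Fin K → ℕ → ℤ) j → columnProduct g (unitColumn j) ≡ g j 0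
  columnProduct-unitColumn {suc K} g Fin.zero = trans (cong (g Fin.zero 0 *_) (columnProduct-noColumn (g ∘ Fin.suc)))
      (ℤₚ.*-identityʳ _)
  columnProduct-unitColumn {suc K} g (Fin.suc j) = trans (ℤₚ.*-identityˡ _) (columnProduct-unitColumn (g ∘ Fin.suc) j)

  weightDot-noColumn : ∀ {K} (w : Fin K → ℕ) → weightDot w (bits (noColumn K)) ≡ 0
  weightDot-noColumn {zero} w = refl
  weightDot-noColumn {suc K} w = cong₂ ℕ._+_ (ℕₚ.*-zeroʳ (w Fin.zero)) (weightDot-noColumn (w ∘ Fin.suc))

  weightDot-unitColumn : ∀ {K} (w : Fin K → ℕ) j → weightDot w (bits (unitColumn j)) ≡ w j
  weightDot-unitColumn {suc K} w Fin.zero = trans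
      (cong₂ ℕ._+_ (ℕₚ.*-identityʳ (w Fin.zero)) (weightDot-noColumn (w ∘ Fin.suc))) (ℕₚ.+-identityʳ _)
  weightDot-unitColumn {suc K} w (Fin.suc j) = cong₂ ℕ._+_ (ℕₚ.*-zeroʳ (w Fin.zero))
      (weightDot-unitColumn (w ∘ Fin.suc) j)

  disjointSum : ∀ {K} (w : Fin K → ℕ) P (g : Fin K → ℕ → ℤ) (q : ℕ) → ℤ
  disjointSum {K} w P g q = ΣL (tuples K P)
      (λ S → if disjoint? S then product g S * δ (weightDot w (cards S)) q else + 0)

  columnSeries : ∀ {K} (w : Fin K → ℕ) (g : Fin K → ℕ → ℤ) (n : ℕ) → ℤ
  columnSeries {K} w g n = ΣL (subsets K)
      (λ col → if atMostOne col then columnProduct g col * δ (weightDot w (bits col)) n else + 0)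

  columnSeries≡ : ∀ {K} (w : Fin K → ℕ) (g : Fin K → ℕ → ℤ) n →
    columnSeries w g n ≡ δ 0 n + ΣFin K (λ j → g j 0 * δ (w j) n)
  columnSeries≡ {K} w g n = trans (ΣL-atMostOne K (λ col → columnProduct g col * δ (weightDot w (bits col)) n))
    (cong₂ _+_ (trans (cong₂ (λ a b → a * δ b n) (columnProduct-noColumn g) (weightDot-noColumn w)) (ℤₚ.*-identityˡ _))
      (ΣFin-cong K (λ j → cong₂ (λ a b → a * δ b n) (columnProduct-unitColumn g j) (weightDot-unitColumn w j))))

  if-cong : ∀ q {β β′ : Bool} {t t′ : ℤ} {w w′ : ℕ} → β ≡ β′ → t ≡ t′ → w ≡ w′ →
    (if β then t * δ w q else + 0) ≡ (if β′ then t′ * δ w′ q else + 0)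
  if-cong q refl refl refl = refl

  if-∧-conv : ∀ q (β1 β2 : Bool) c1 c2 a b → (if β1 ∧ β2 then c1 * c2 * δ (a ℕ.+ b) q else + 0) ≡
    conv (λ n → if β1 then c1 * δ a n else + 0) (λ n → if β2 then c2 * δ b n else + 0) q
  if-∧-conv q true true c1 c2 a b = sym (trans (conv-*ˡ c1 (δ a) (λ n → c2 * δ b n) q)
    (trans (cong (c1 *_) (conv-*ʳ c2 (δ a) (δ b) q))
      (trans (cong (λ z → c1 * (c2 * z)) (conv-δ-δ a b q)) (sym (ℤₚ.*-assoc c1 c2 _)))))
  if-∧-conv q true false c1 c2 a b = sym (conv-zeroʳ (λ n → c1 * δ a n) q)
  if-∧-conv q false β2 c1 c2 a b = sym (conv-zeroˡ (λ n → if β2 then c2 * δ b n else + 0) q)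

  disjointSum-suc : ∀ {K} (w : Fin K → ℕ) P (g : Fin K → ℕ → ℤ) q →
    disjointSum w (suc P) g q ≡ conv (columnSeries w g) (disjointSum w P (λ j i → g j (suc i))) q
  disjointSum-suc {K} w P g q = begin
      disjointSum w (suc P) g q
    ≡⟨ ΣL-tuples-addColumn K P _ ⟩
      ΣL (tuples K P) (λ S → ΣL (subsets K) (λ col → Φ (addColumn col S)))
    ≡⟨ ΣL-cong (tuples K P) (λ S → ΣL-cong (subsets K) (λ col → split-column-0 col S)) ⟩
      ΣL (tuples K P) (λ S → ΣL (subsets K) (λ col → conv (A col) (B S) q))
    ≡⟨ ΣL-comm (tuples K P) (subsets K) (λ S col → conv (A col) (B S) q) ⟩
      ΣL (subsets K) (λ col → ΣL (tuples K P) (λ S → conv (A col) (B S) q))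
    ≡⟨ ΣL-cong (subsets K) (λ col → sym (conv-ΣLʳ (tuples K P) (A col) B q)) ⟩
      ΣL (subsets K) (λ col → conv (A col) (λ n → ΣL (tuples K P) (λ S → B S n)) q)
    ≡⟨ sym (conv-ΣLˡ (subsets K) A (λ n → ΣL (tuples K P) (λ S → B S n)) q) ⟩
      conv (columnSeries w g) (disjointSum w P g′) q
    ∎
    where
    open ≡-Reasoning
    g′ : Fin K → ℕ → ℤ
    g′ j i = g j (suc i)
    Φ : Vec (Subset (suc P)) K → ℤ
    Φ S = if disjoint? S then product g S * δ (weightDot w (cards S)) q else + 0
    A : Vec Bool K → ℕ → ℤ
    A col n = if atMostOne col then columnProduct g col * δ (weightDot w (bits col)) n else + 0
    B : Vec (Subset P) K → ℕ → ℤ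
    B S n = if disjoint? S then product g′ S * δ (weightDot w (cards S)) n else + 0
    split-column-0 : ∀ col S → Φ (addColumn col S) ≡ conv (A col) (B S) q
    split-column-0 col S = trans
      (if-cong q (disjoint?-addColumn col S) (product-addColumn g col S) (weightDot-addColumn w col S))
      (if-∧-conv q (atMostOne col) (disjoint? S) (columnProduct g col) (product g′ S) (weightDot w (bits col))
        (weightDot w (cards S)))

  disjoint?-empty : ∀ K → disjoint? (Vec.replicate K ([] {A = Bool})) ≡ true
  disjoint?-empty zero = refl
  disjoint?-empty (suc K) = cong₂ _∧_ (h K) (disjoint?-empty K)
    where
    h : ∀ K → allᵇ P₀ KS (disjointᵇ P₀ KS []) (Vec.replicate K ([] {A = Bool})) ≡ true
    h zero = refl
    h (suc K) = h K

  weightDot-empty : ∀ {K} (w : Fin K → ℕ) → weightDot w (cards (Vec.replicate K ([] {A = Bool}))) ≡ 0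
  weightDot-empty {zero} w = refl
  weightDot-empty {suc K} w = cong₂ ℕ._+_ (ℕₚ.*-zeroʳ (w Fin.zero)) (weightDot-empty (w ∘ Fin.suc))

  disjointSum-0 : ∀ {K} (w : Fin K → ℕ) (g : Fin K → ℕ → ℤ) q → disjointSum w 0 g q ≡ δ 0 q
  disjointSum-0 {K} w g q = trans (ΣL-tuples-0 K _)
      (trans (if-cong q (disjoint?-empty K) (ΠFin-one K (λ j → refl)) (weightDot-empty w)) (ℤₚ.*-identityˡ _))


module DigitFormula (p : ℕ) (p-prime : Prime p) (ks : List (Vec ℕ (p ∸ 1)))
    (ks-enumerates : ∀ k → (k ∈ ks) ⇔ ((Vec.sum k ≤ p ∸ 1) × (k ≢ Vec.replicate (p ∸ 1) 0)))
    (ks-unique : Unique ks) where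
  open import Data.Integer using (_+_; _*_)
  open Series
  open Congruence p p-prime
  open BinomialModP p p-prime
  open Horner p
  open Multinomial p ks using (bounded; ΣL-bounded-eqV)
  open DigitProduct p p-prime ks ks-enumerates ks-unique using (digit-product)
  open DisjointTuples p ks

  weights : Fin (K p ks) → ℕ
  weights j = wt p (kk p ks j)

  πs : ℕ → (ℕ → ℤ) → (ℕ → ℤ) → Fin (K p ks) → ℕ → ℤ
  πs m x y j i = πₚ p (kk p ks j) (x i) (y (m ∸ i))

  τ≡ΣL-tuples : ∀ l m x y →
    τ p ks l m x y ≡ ΣL (tuples (K p ks) (suc m))
        (λ S → if disjoint? S ∧ cardsᵇ p ks S l then product (πs m x y) S else + 0)
  τ≡ΣL-tuples l m x y = ΣL-filterᵇ (λ S → disjoint? S ∧ cardsᵇ p ks S l) (tuples (K p ks) (suc m)) (product (πs m x y))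

  ΣL-τ≡disjointSum : ∀ m x y q →
    ΣL (bounded (K p ks) (suc m)) (λ l → τ p ks l m x y * δ (wdot p ks l) q) ≡ disjointSum weights (suc m) (πs m x y) q
  ΣL-τ≡disjointSum m x y q = begin
      ΣL (bounded (K p ks) (suc m)) (λ l → τ p ks l m x y * δ (wdot p ks l) q)
    ≡⟨ ΣL-cong (bounded (K p ks) (suc m)) (λ l → trans (cong (_* δ (wdot p ks l) q) (τ≡ΣL-tuples l m x y))
         (trans (ΣL-*ʳ (tuples (K p ks) (suc m)) _ (δ (wdot p ks l) q))
           (ΣL-cong (tuples (K p ks) (suc m)) (λ S → if-*ʳ (disjoint? S ∧ cardsᵇ p ks S l))))) ⟩
      ΣL (bounded (K p ks) (suc m)) (λ l → ΣL (tuples (K p ks) (suc m)) (λ S → summand S l))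
    ≡⟨ ΣL-comm (bounded (K p ks) (suc m)) (tuples (K p ks) (suc m)) (λ l S → summand S l) ⟩
      ΣL (tuples (K p ks) (suc m)) (λ S → ΣL (bounded (K p ks) (suc m)) (summand S))
    ≡⟨ ΣL-cong (tuples (K p ks) (suc m)) only-cards ⟩
      disjointSum weights (suc m) (πs m x y) q
    ∎
    where
    open ≡-Reasoning
    summand : Vec (Subset (suc m)) (K p ks) → Vec ℕ (K p ks) → ℤ
    summand S l = if disjoint? S ∧ cardsᵇ p ks S l then product (πs m x y) S * δ (wdot p ks l) q else + 0
    if-*ʳ : ∀ β {t c} → (if β then t else + 0) * c ≡ (if β then t * c else + 0)
    if-*ʳ true          = refl
    if-*ʳ false {c = c} = ℤₚ.*-zeroˡ c
    only-cards : ∀ S → ΣL (bounded (K p ks) (suc m)) (summand S)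
                     ≡ (if disjoint? S then product (πs m x y) S * δ (weightDot weights (cards S)) q else + 0)
    only-cards S with disjoint? S in e
    ... | false = ΣL-zero (bounded (K p ks) (suc m))
    ... | true  = trans (ΣL-cong (bounded (K p ks) (suc m))
                    (λ l → cong (λ β → if β then product (πs m x y) S * δ (wdot p ks l) q else + 0) (cardsᵇ≡eqV S l)))
                  (ΣL-bounded-eqV (K p ks) (suc m) (cards S) (λ l → product (πs m x y) S * δ (wdot p ks l) q)
                      (disjoint⇒sum≤ (suc m) S e))

  πXY : (ℕ → ℕ) → (ℕ → ℕ) → Fin (K p ks) → ℕ → ℤ
  πXY X Y j i = πₚ p (kk p ks j) (+ X i) (+ Y i)

  disjointSum≈binom : ∀ P X Y → (∀ i → X i < p) → (∀ i → Y i < p) → ∀ q →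
    disjointSum weights P (πXY X Y) q ≈ binom (dot P X Y) q
  disjointSum≈binom zero    X Y X<p Y<p q = ≡⇒≈ (trans (disjointSum-0 weights (πXY X Y) q) (sym (binom-0 q)))
  disjointSum≈binom (suc P) X Y X<p Y<p q = begin
      disjointSum weights (suc P) (πXY X Y) q
    ≡⟨ disjointSum-suc weights P (πXY X Y) q ⟩
      conv (columnSeries weights (πXY X Y)) (disjointSum weights P (πXY (X ∘ suc) (Y ∘ suc))) q
    ≈⟨ conv-≈ q (λ n _ → first-column n) (λ n _ → disjointSum≈binom P (X ∘ suc) (Y ∘ suc) (X<p ∘ suc) (Y<p ∘ suc) n) ⟩
      conv (binom (X 0 ℕ.* Y 0)) (binom (dot P (X ∘ suc) (Y ∘ suc))) q
    ≡⟨ vandermonde (X 0 ℕ.* Y 0) _ q ⟨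
      binom (dot (suc P) X Y) q
    ∎
    where
    open ≈-Reasoning
    first-column : ∀ n → columnSeries weights (πXY X Y) n ≈ binom (X 0 ℕ.* Y 0) n
    first-column n = ≈-trans (≡⇒≈ (trans (columnSeries≡ weights (πXY X Y) n)
        (cong (_+_ (δ 0 n)) (ΣFin-lookup ks (λ k → πₚ p k (+ X 0) (+ Y 0) * δ (wt p k) n)))))
      (digit-product (X 0) (Y 0) (X<p 0) (Y<p 0) n)

  module _ (a b : ℕ → ℕ) (a<p : ∀ i → a i < p) (b<p : ∀ i → b i < p) where
    x y : ℕ → ℤ
    x i = + a i
    y i = + b i

    levelSeries : ℕ → ℕ → ℤ
    levelSeries m n = ΣL (bounded (K p ks) (suc m)) (λ l → τ p ks l m x y * δ (wdot p ks l ℕ.* p ℕ.^ m) n)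

    levelSeries≈binom : ∀ m n → levelSeries m n ≈ binom (p ℕ.^ m ℕ.* convℕ a b m) n
    levelSeries≈binom m = frobenius-substitution (bounded (K p ks) (suc m)) (λ l → τ p ks l m x y) (wdot p ks)
      (convℕ a b m) level-m m
      where
      level-m : ∀ q → ΣL (bounded (K p ks) (suc m)) (λ l → τ p ks l m x y * δ (wdot p ks l) q) ≈ binom (convℕ a b m) q
      level-m q = ≈-trans (≡⇒≈ (ΣL-τ≡disjointSum m x y q))
        (disjointSum≈binom (suc m) a (λ i → b (m ∸ i)) a<p (λ i → b<p (m ∸ i)) q)

    sequenceSeries : ℕ → ℕ → ℕ → ℤ
    sequenceSeries m c N = ΣL (seqsFrom p ks m c) (λ ls → δ (weightSum p ks m ls) N * τProd p ks m ls x y)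

    sequenceSeries-suc : ∀ m c N → sequenceSeries m (suc c) N ≡ conv (levelSeries m) (sequenceSeries (suc m) c) N
    sequenceSeries-suc m c N = begin
        sequenceSeries m (suc c) N
      ≡⟨ ΣL-concatMap (λ l → map (l ∷_) (seqsFrom p ks (suc m) c)) (bounded (K p ks) (suc m)) _ ⟩
        ΣL (bounded (K p ks) (suc m)) (λ l → ΣL (map (l ∷_) (seqsFrom p ks (suc m) c)) term)
      ≡⟨ ΣL-cong (bounded (K p ks) (suc m)) (λ l → trans (ΣL-map (l ∷_) (seqsFrom p ks (suc m) c) term)
           (ΣL-cong (seqsFrom p ks (suc m) c) (term-∷ l))) ⟩
        ΣL (bounded (K p ks) (suc m)) (λ l → ΣL (seqsFrom p ks (suc m) c) (λ ls → conv (level l) (rest ls) N))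
      ≡⟨ ΣL-cong (bounded (K p ks) (suc m)) (λ l → conv-ΣLʳ (seqsFrom p ks (suc m) c) (level l) rest N) ⟨
        ΣL (bounded (K p ks) (suc m)) (λ l → conv (level l) (sequenceSeries (suc m) c) N)
      ≡⟨ conv-ΣLˡ (bounded (K p ks) (suc m)) level (sequenceSeries (suc m) c) N ⟨
        conv (levelSeries m) (sequenceSeries (suc m) c) N
      ∎
      where
      open ≡-Reasoning
      term : List (Vec ℕ (K p ks)) → ℤ
      term ls = δ (weightSum p ks m ls) N * τProd p ks m ls x y
      level : Vec ℕ (K p ks) → ℕ → ℤ
      level l n = τ p ks l m x y * δ (wdot p ks l ℕ.* p ℕ.^ m) n
      rest : List (Vec ℕ (K p ks)) → ℕ → ℤ
      rest ls n = δ (weightSum p ks (suc m) ls) n * τProd p ks (suc m) ls x y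
      term-∷ : ∀ l ls → term (l ∷ ls) ≡ conv (level l) (rest ls) N
      term-∷ l ls = sym (trans (conv-*ˡ τₗ (δ u) (rest ls) N)
        (trans (cong (τₗ *_) (conv-δ-δ*ʳ u (weightSum p ks (suc m) ls) τₗₛ N))
            (*-left-comm τₗ (δ (u ℕ.+ weightSum p ks (suc m) ls) N) τₗₛ)))
        where
        τₗ τₗₛ : ℤ
        τₗ  = τ p ks l m x y
        τₗₛ = τProd p ks (suc m) ls x y
        u : ℕ
        u = wdot p ks l ℕ.* p ℕ.^ m

    convTail : ℕ → ℕ → ℕ
    convTail m f = horner (λ i → convℕ a b (m ℕ.+ i)) f

    -- Levels ≥ t + 1 only move coefficients of z^N with N ≥ p^(t+1), so any number g of them may be appended.
    sequenceSeries≈binom : ∀ t c m N g → m ℕ.+ c ≡ suc t → N < p ℕ.^ suc t →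
      sequenceSeries m c N ≈ binom (p ℕ.^ m ℕ.* convTail m (c ℕ.+ g)) N
    sequenceSeries≈binom t zero m N g m+0≡1+t N<p^[1+t] =
      ≈-trans (≡⇒≈ (trans (ℤₚ.+-identityʳ _) (ℤₚ.*-identityʳ _))) (≈-sym (binom-p^m*-low m (convTail m g) N N<p^m))
      where
      N<p^m : N < p ℕ.^ m
      N<p^m = subst (λ e → N < p ℕ.^ e) (sym (trans (sym (ℕₚ.+-identityʳ m)) m+0≡1+t)) N<p^[1+t]
    sequenceSeries≈binom t (suc c) m N g m+[1+c]≡1+t N<p^[1+t] = begin
        sequenceSeries m (suc c) N
      ≡⟨ sequenceSeries-suc m c N ⟩
        conv (levelSeries m) (sequenceSeries (suc m) c) N
      ≈⟨ conv-≈ N (λ n _ → levelSeries≈binom m n)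
           (λ n n≤N → sequenceSeries≈binom t c (suc m) n g (trans (sym (ℕₚ.+-suc m c)) m+[1+c]≡1+t)
               (ℕₚ.≤-<-trans n≤N N<p^[1+t])) ⟩
        conv (binom (p ℕ.^ m ℕ.* convℕ a b m)) (binom (p ℕ.^ suc m ℕ.* convTail (suc m) (c ℕ.+ g))) N
      ≡⟨ vandermonde (p ℕ.^ m ℕ.* convℕ a b m) _ N ⟨
        binom (p ℕ.^ m ℕ.* convℕ a b m ℕ.+ p ℕ.^ suc m ℕ.* convTail (suc m) (c ℕ.+ g)) N
      ≡⟨ cong (λ z → binom z N) convTail-suc ⟩
        binom (p ℕ.^ m ℕ.* convTail m (suc c ℕ.+ g)) N
      ∎
      where
      open ≈-Reasoning
      factor : ∀ X A p B → X ℕ.* A ℕ.+ p ℕ.* X ℕ.* B ≡ X ℕ.* (A ℕ.+ p ℕ.* B)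
      factor = ℕ-Solver.solve-∀
      convTail-suc :
        p ℕ.^ m ℕ.* convℕ a b m ℕ.+ p ℕ.^ suc m ℕ.* convTail (suc m) (c ℕ.+ g) ≡ p ℕ.^ m ℕ.* convTail m (suc c ℕ.+ g)
      convTail-suc = trans (cong₂ (λ u v → p ℕ.^ m ℕ.* convℕ a b u ℕ.+ p ℕ.^ suc m ℕ.* v) (sym (ℕₚ.+-identityʳ m))
          (horner-cong (c ℕ.+ g) (λ i → cong (convℕ a b) (sym (ℕₚ.+-suc m i)))))
        (factor (p ℕ.^ m) (convℕ a b (m ℕ.+ 0)) p (horner (λ i → convℕ a b (m ℕ.+ suc i)) (c ℕ.+ g)))

    convTail-0≡product : ∀ r → (∀ i → r < i → a i ≡ 0) → (∀ i → r < i → b i ≡ 0) → ∀ t →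
      convTail 0 (suc t ℕ.+ (r ℕ.+ suc r)) ≡ horner a (suc r) ℕ.* horner b (suc r)
    convTail-0≡product r a≡0 b≡0 t = begin
        horner (convℕ a b) (suc t ℕ.+ (r ℕ.+ suc r))
      ≡⟨ cong (horner (convℕ a b)) (rearrange t r) ⟩
        horner (convℕ a b) (r ℕ.+ (suc r ℕ.+ suc t))
      ≡⟨ horner-convℕ r a b (suc r ℕ.+ suc t) a≡0 (λ i le → b≡0 i (ℕₚ.<-≤-trans (s≤s (ℕₚ.m≤m+n r (suc t))) le)) ⟩
        horner a (suc r) ℕ.* horner b (suc r ℕ.+ suc t)
      ≡⟨ cong (horner a (suc r) ℕ.*_) (horner-truncate (suc r) (suc t) b≡0) ⟩
        horner a (suc r) ℕ.* horner b (suc r)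
      ∎
      where
      open ≡-Reasoning
      rearrange : ∀ t r → suc t ℕ.+ (r ℕ.+ suc r) ≡ r ℕ.+ (suc r ℕ.+ suc t)
      rearrange = ℕ-Solver.solve-∀

    rhs≈binom-product : ∀ r → (∀ i → r < i → a i ≡ 0) → (∀ i → r < i → b i ≡ 0) → ∀ t →
      rhs p ks t x y ≈ binom (horner a (suc r) ℕ.* horner b (suc r)) (p ℕ.^ t)
    rhs≈binom-product r a≡0 b≡0 t = begin
        rhs p ks t x y
      ≡⟨ trans (ΣL-filter (λ ls → weightSum p ks 0 ls ℕ.≟ p ℕ.^ t) (seqsFrom p ks 0 (suc t))
           (λ ls → τProd p ks 0 ls x y))
           (ΣL-cong (seqsFrom p ks 0 (suc t)) (λ ls → if≡δ (weightSum p ks 0 ls) (p ℕ.^ t))) ⟩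
        sequenceSeries 0 (suc t) (p ℕ.^ t)
      ≈⟨ sequenceSeries≈binom t (suc t) 0 (p ℕ.^ t) (r ℕ.+ suc r) refl p^t<p^[1+t] ⟩
        binom (1 ℕ.* convTail 0 (suc t ℕ.+ (r ℕ.+ suc r))) (p ℕ.^ t)
      ≡⟨ cong (λ z → binom z (p ℕ.^ t)) (trans (ℕₚ.*-identityˡ _) (convTail-0≡product r a≡0 b≡0 t)) ⟩
        binom (horner a (suc r) ℕ.* horner b (suc r)) (p ℕ.^ t)
      ∎
      where
      open ≈-Reasoning
      if≡δ : ∀ u v {T} → (if does (u ℕ.≟ v) then T else + 0) ≡ δ u v * T
      if≡δ u v {T} with u ≡ᵇ v
      ... | true  = sym (ℤₚ.*-identityˡ T)
      ... | false = sym (ℤₚ.*-zeroˡ T)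
      p^t<p^[1+t] : p ℕ.^ t < p ℕ.^ suc t
      p^t<p^[1+t] = subst (p ℕ.^ t <_) (ℕₚ.*-comm (p ℕ.^ t) p) (ℕₚ.m<m*n (p ℕ.^ t) p {{ℕ.>-nonZero (ℕₚ.m^n>0 p t)}} 1<p)

open import Data.Nat using (_+_; _*_; _^_)
open import Data.Integer using (_-_)
open import Data.Integer.Divisibility using (_∣_)
open import Data.Vec using (replicate; sum)

theorem4p4 :
    (p : ℕ) → Prime p →
    (ks : List (Vec ℕ (p ∸ 1))) → Unique ks →
    (∀ k → (k ∈ ks) ⇔ ((sum k ≤ p ∸ 1) × (k ≢ replicate (p ∸ 1) 0))) →
    (r : ℕ) (a b e : ℕ → ℕ) →
    (∀ i → i ≤ r → a i < p) → (∀ i → r < i → a i ≡ 0) →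
    (∀ i → i ≤ r → b i < p) → (∀ i → r < i → b i ≡ 0) →
    (∀ i → i ≤ 2 * r + 1 → e i < p) →
    Σ≤ r (λ i → a i * p ^ i) * Σ≤ r (λ i → b i * p ^ i) ≡ Σ≤ (2 * r + 1) (λ i → e i * p ^ i) →
    ((+ p) ∣ (+ e 0 - + (a 0 * b 0)))
    × (∀ t → 1 ≤ t → t ≤ 2 * r + 1 →
         (+ p) ∣ (+ e t - rhs p ks t (λ i → + a i) (λ i → + b i)))
theorem4p4 p p-prime ks ks-unique ks-enumerates r a b e a<p a≡0 b<p b≡0 e<p AB≡E =
  ≈⇒∣ e₀≈a₀b₀ , λ t _ t≤2r+1 → ≈⇒∣ (≈-sym (rhs≈eₜ t t≤2r+1))
  where
  open Series using (binom)
  open Congruence p p-prime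
  open BinomialModP p p-prime
  open Horner p
  open DigitFormula p p-prime ks ks-enumerates ks-unique
  open ≈-Reasoning

  product≡horner-e : horner a (suc r) * horner b (suc r) ≡ horner e (suc (2 * r + 1))
  product≡horner-e = trans (sym (cong₂ _*_ (Σ≤≡horner r a) (Σ≤≡horner r b))) (trans AB≡E (Σ≤≡horner (2 * r + 1) e))

  e₀≈a₀b₀ : + e 0 ≈ + (a 0 * b 0)
  e₀≈a₀b₀ = begin
      + e 0                                         ≈⟨ horner≈head e (2 * r + 1) ⟨
      + horner e (suc (2 * r + 1))                  ≡⟨ cong +_ product≡horner-e ⟨
      + (horner a (suc r) * horner b (suc r))       ≈⟨ horner*horner≈head a b r r ⟩
      + (a 0 * b 0)                                 ∎

  rhs≈eₜ : ∀ t → t ≤ 2 * r + 1 → rhs p ks t (λ i → + a i) (λ i → + b i) ≈ + e t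
  rhs≈eₜ t t≤2r+1 = begin
      rhs p ks t (λ i → + a i) (λ i → + b i)
    ≈⟨ rhs≈binom-product a b (digits<p 0<p a<p a≡0) (digits<p 0<p b<p b≡0) r a≡0 b≡0 t ⟩
      binom (horner a (suc r) * horner b (suc r)) (p ^ t)
    ≡⟨ cong (λ n → binom n (p ^ t)) product≡horner-e ⟩
      binom (horner e (suc (2 * r + 1))) (p ^ t)
    ≈⟨ lucas-digit t _ e (s≤s t≤2r+1) (λ i i<2r+2 → e<p i (ℕₚ.≤-pred i<2r+2)) ⟩
      + e t
    ∎
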